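{- Let $\mathbb{F}$ be an infinite field, $\Delta$ a $2$-dimensional simplicial complex, and $\pi$ a semi-proper bi-coloring of $\Delta$. Then for a generic choice of blue linear forms $\theta_1,\theta_2$ and a generic linear form $\theta_3$ (i.e. for all choices of coefficients outside a proper Zariski-closed subset of the space of such coefficient vectors), $\theta_1,\theta_2,\theta_3$ is a linear system of parameters for $\mathbb{F}[\Delta]$.
   Context: $\mathbb{F}[\Delta]=\mathbb{F}[x_v:v\in V(\Delta)]/I_\Delta$ is the Stanley--Reisner ring. A linear system of parameters for a $2$-dimensional $\Delta$ is a sequence of three linear forms $\Theta$ with $\dim_\mathbb{F}\mathbb{F}[\Delta]/\Theta\mathbb{F}[\Delta]<\infty$. A bi-coloring is a map $\pi:V(\Delta)\to\{b,r\}$ (blue/red vertices); it is semi-proper if there is no edge $\{u,v\}\in\Delta$ with $\pi(u)=\pi(v)=r$. A linear form $\sum_v\alpha_vx_v$ is blue if $\alpha_v=0$ for every red $v$. -}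

module Defs where

open import Level using (Level; _⊔_) renaming (suc to lsuc)
open import Algebra.Bundles using (CommutativeRing)
open import Data.Nat as ℕ using (ℕ; _≤_)
import Data.Nat.Properties as ℕP
open import Data.Bool using (Bool; true; false; if_then_else_)
open import Data.Fin using (Fin; _≟_)
open import Data.Fin.Subset using (Subset; _⊆_; ⁅_⁆; _∪_; ∣_∣)
open import Data.List as List using (List; []; _∷_; _++_; foldr; concatMap; zipWith)
open import Data.List.Relation.Unary.All using (All)
open import Data.Vec as Vec using (Vec; tabulate; lookup)
import Data.Vec.Properties as VecP
open import Data.Product using (Σ; ∃; _×_; _,_; proj₁; proj₂)
open import Relation.Nullary using (¬_; Dec; yes; no)
open import Relation.Nullary.Decidable using (⌊_⌋)
open import Relation.Binary.PropositionalEquality using (_≡_; _≢_)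

record Field (c ℓ : Level) : Set (lsuc (c ⊔ ℓ)) where
  field
    commutativeRing : CommutativeRing c ℓ
  open CommutativeRing commutativeRing public
  field
    1≉0 : ¬ (1# ≈ 0#)
    inverse : ∀ x → ¬ (x ≈ 0#) → ∃ λ y → x * y ≈ 1#

Infinite : ∀ {c ℓ} → Field c ℓ → Set (c ⊔ ℓ)
Infinite F = ∀ (xs : List Carrier) → ∃ λ x → All (λ y → ¬ (x ≈ y)) xs
  where open Field F

record SimplicialComplex (n : ℕ) : Set₁ where
  field
    Face     : Subset n → Set
    downward : ∀ {S T} → S ⊆ T → Face T → Face S
    vertex   : ∀ v → Face ⁅ v ⁆

open SimplicialComplex public

Is2Dimensional : ∀ {n} → SimplicialComplex n → Set
Is2Dimensional Δ =
  (∀ S → Face Δ S → ∣ S ∣ ≤ 3) × (∃ λ S → Face Δ S × ∣ S ∣ ≡ 3)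

data Color : Set where
  blue red : Color

SemiProper : ∀ {n} → SimplicialComplex n → (Fin n → Color) → Set
SemiProper Δ π = ∀ u v → u ≢ v → Face Δ (⁅ u ⁆ ∪ ⁅ v ⁆) →
  ¬ (π u ≡ red × π v ≡ red)

-- Polynomials over a commutative ring in variables x_0..x_{m-1},
-- represented as formal sums of terms c·x^e (e an exponent vector);
-- two polynomials are equal iff all their coefficients agree.

module Polynomials {c ℓ} (F : Field c ℓ) where
  open Field F

  Mono : ℕ → Set
  Mono m = Vec ℕ m

  Poly : ℕ → Set c
  Poly m = List (Carrier × Mono m)

  _≟ₘ_ : ∀ {m} (e f : Mono m) → Dec (e ≡ f)
  _≟ₘ_ = VecP.≡-dec ℕP._≟_

  coeff : ∀ {m} → Poly m → Mono m → Carrier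
  coeff p e = foldr (λ t acc → (if ⌊ proj₂ t ≟ₘ e ⌋ then proj₁ t else 0#) + acc) 0# p

  _≐_ : ∀ {m} → Poly m → Poly m → Set ℓ
  p ≐ q = ∀ e → coeff p e ≈ coeff q e

  0ₚ : ∀ {m} → Poly m
  0ₚ = []

  _+ₚ_ : ∀ {m} → Poly m → Poly m → Poly m
  _+ₚ_ = _++_

  -ₚ_ : ∀ {m} → Poly m → Poly m
  -ₚ_ = List.map (λ t → (- proj₁ t , proj₂ t))

  _-ₚ_ : ∀ {m} → Poly m → Poly m → Poly m
  p -ₚ q = p +ₚ (-ₚ q)

  _*ₚ_ : ∀ {m} → Poly m → Poly m → Poly m
  p *ₚ q = concatMap (λ s → List.map (λ t →
             (proj₁ s * proj₁ t , Vec.zipWith ℕ._+_ (proj₂ s) (proj₂ t))) q) p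

  _·ₚ_ : ∀ {m} → Carrier → Poly m → Poly m
  a ·ₚ p = List.map (λ t → (a * proj₁ t , proj₂ t)) p

  lincomb : ∀ {m} → List Carrier → List (Poly m) → Poly m
  lincomb as bs = foldr _+ₚ_ 0ₚ (zipWith _·ₚ_ as bs)

  unit : ∀ {m} → Fin m → Mono m
  unit i = tabulate (λ j → if ⌊ i ≟ j ⌋ then 1 else 0)

  _^_ : Carrier → ℕ → Carrier
  x ^ ℕ.zero  = 1#
  x ^ ℕ.suc k = x * (x ^ k)

  evalMono : ∀ {m} → Vec Carrier m → Mono m → Carrier
  evalMono x e = Vec.foldr _ _*_ 1# (Vec.zipWith _^_ x e)

  eval : ∀ {m} → Poly m → Vec Carrier m → Carrier
  eval p x = foldr (λ t acc → proj₁ t * evalMono x (proj₂ t) + acc) 0# p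

module StanleyReisner {c ℓ} (F : Field c ℓ) where
  open Field F
  open Polynomials F

  -- a linear form Σ_v α_v x_v is given by its coefficient vector α
  LinearForm : ℕ → Set c
  LinearForm n = Vec Carrier n

  linPoly : ∀ {n} → LinearForm n → Poly n
  linPoly {n} α = List.tabulate (λ v → (lookup α v , unit v))

  IsBlue : ∀ {n} → (Fin n → Color) → LinearForm n → Set ℓ
  IsBlue π α = ∀ v → π v ≡ red → lookup α v ≈ 0#

  xSet : ∀ {n} → Subset n → Poly n
  xSet S = (1# , Vec.map (λ b → if b then 1 else 0) S) ∷ []

  InIΔ : ∀ {n} → SimplicialComplex n → Poly n → Set (c ⊔ ℓ)
  InIΔ {n} Δ h = ∃ λ (gs : List (Poly n × Σ (Subset n) (λ S → ¬ Face Δ S))) →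
    h ≐ foldr (λ g acc → (proj₁ g *ₚ xSet (proj₁ (proj₂ g))) +ₚ acc) 0ₚ gs

  -- membership in I_Δ + (θ₁,θ₂,θ₃), i.e. p ≡ 0 in F[Δ]/ΘF[Δ]
  InJ : ∀ {n} → SimplicialComplex n → (θ₁ θ₂ θ₃ : LinearForm n) → Poly n → Set (c ⊔ ℓ)
  InJ {n} Δ θ₁ θ₂ θ₃ p = ∃ λ (g₁ : Poly n) → ∃ λ (g₂ : Poly n) → ∃ λ (g₃ : Poly n) →
    ∃ λ (h : Poly n) → InIΔ Δ h ×
      (p ≐ ((g₁ *ₚ linPoly θ₁) +ₚ ((g₂ *ₚ linPoly θ₂) +ₚ ((g₃ *ₚ linPoly θ₃) +ₚ h))))

  FiniteDimQuotient : ∀ {n} → SimplicialComplex n → (θ₁ θ₂ θ₃ : LinearForm n) → Set (c ⊔ ℓ)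
  FiniteDimQuotient {n} Δ θ₁ θ₂ θ₃ = ∃ λ (bs : List (Poly n)) → ∀ (p : Poly n) →
    ∃ λ (as : List Carrier) → InJ Δ θ₁ θ₂ θ₃ (p -ₚ lincomb as bs)

  IsLSOP : ∀ {n} → SimplicialComplex n → (θ₁ θ₂ θ₃ : LinearForm n) → Set (c ⊔ ℓ)
  IsLSOP = FiniteDimQuotient

module Submission where

-- Since dim Δ = 2, F[Δ]/(Θ) is spanned by monomials all of whose exponents are at most 3,
-- so it suffices that every monomial with some exponent ≥ 4 lies in J = I_Δ + (θ₁, θ₂, θ₃).
-- If L = c₁θ₁ + c₂θ₂ + c₃θ₃ has L(u) = 1, then x_u·m ≡ −Σ_{y ≠ u} L(y)·x_y·m modulo J; choosing L
-- to vanish on the other vertices of the current support (possible when the corresponding minor of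
-- the matrix (θᵢ(v)) is nonzero) and using that a support with four vertices or with a red edge is
-- not a face, one reduces x_u⁴ ⇝ x_u³x_v ⇝ x_u²x_vx_w ⇝ 0. The product of all these minors is the
-- required polynomial: with blue vertices at (1, t, t²) and red ones at (0, 0, 1) every relevant
-- minor is a nonzero Vandermonde-type determinant, so it does not vanish at some blue point.

open import Defs
open import Level using (_⊔_)
open import Algebra.Bundles using (CommutativeRing; RawRing)
open import Data.Bool using (Bool; true; false; if_then_else_)
open import Data.Empty using (⊥-elim)
open import Data.Fin as Fin using (Fin; zero; suc; _↑ˡ_; _↑ʳ_)
import Data.Fin.Properties as FinP
open import Data.Fin.Subset using (Subset; _∈_; ∣_∣; ⁅_⁆; _∪_; _⊆_)
open import Data.Fin.Subset.Properties
  using (x∈p⇒∣p-x∣<∣p∣; x∈p∧x≢y⇒x∈p-y; x∈p∪q⁻; x∈⁅y⁆⇒x≡y)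
open import Data.Integer as ℤ using (ℤ; +_; -[1+_])
import Data.Integer.Properties as ℤP
open import Data.List as List using (List; []; _∷_; length)
import Data.List
import Data.List.Properties as ListP
open import Data.List.Relation.Unary.All using (All; []; _∷_)
open import Data.List.Relation.Unary.Any using (here; there)
open import Data.List.Relation.Unary.Unique.Propositional using (Unique)
open import Data.List.Relation.Unary.AllPairs using ([]; _∷_)
import Data.List.Membership.Propositional as Membership
open import Data.List.Membership.Propositional.Properties using (∈-allFin; ∈-cartesianProductWith⁺)
open import Data.Maybe using (Maybe; just; nothing)
open import Data.Nat as ℕ using (ℕ; zero; suc; _≤_; z≤n; s≤s)
import Data.Nat.Properties as ℕP
open import Data.Product using (Σ; ∃; _×_; _,_; proj₁; proj₂)
open import Data.Sum using (_⊎_; inj₁; inj₂)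
open import Data.Vec as Vec using (Vec; lookup; tabulate)
import Data.Vec.Properties as VecP
open import Relation.Nullary using (¬_; Dec; yes; no; map′)
open import Relation.Nullary.Decidable using (⌊_⌋; _×-dec_; ¬?)
open import Relation.Binary.PropositionalEquality as ≡ using (_≡_; _≢_)

module ℤ-CoefficientSolver {c ℓ} (R : CommutativeRing c ℓ) where
  open CommutativeRing R
  open import Algebra.Properties.Ring ring using (-0#≈0#; -‿involutive; -‿distribˡ-*; -‿distribʳ-*)
  open import Algebra.Properties.Semiring.Mult semiring using (×-homo-+; ×1-homo-*) renaming (_×_ to _·ℕ_)
  open import Algebra.Properties.AbelianGroup +-abelianGroup using (⁻¹-∙-comm)
  open import Algebra.Properties.CommutativeSemigroup +-commutativeSemigroup using (interchange)
  open import Algebra.Solver.Ring.AlmostCommutativeRing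
  open import Relation.Binary.Reasoning.Setoid setoid

  ⟦_⟧ℤ : ℤ → Carrier
  ⟦ + n ⟧ℤ      = n ·ℕ 1#
  ⟦ -[1+ n ] ⟧ℤ = - (suc n ·ℕ 1#)

  ⟦⟧ℤ-homo-neg : ∀ i → ⟦ ℤ.- i ⟧ℤ ≈ - ⟦ i ⟧ℤ
  ⟦⟧ℤ-homo-neg (+ zero)  = sym -0#≈0#
  ⟦⟧ℤ-homo-neg (+ suc n) = refl
  ⟦⟧ℤ-homo-neg -[1+ n ]  = sym (-‿involutive _)

  ⟦⟧ℤ-homo-⊖ : ∀ m n → ⟦ m ℤ.⊖ n ⟧ℤ ≈ m ·ℕ 1# - n ·ℕ 1#
  ⟦⟧ℤ-homo-⊖ m       zero    = sym (trans (+-congˡ -0#≈0#) (+-identityʳ _))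
  ⟦⟧ℤ-homo-⊖ zero    (suc n) = sym (+-identityˡ _)
  ⟦⟧ℤ-homo-⊖ (suc m) (suc n) = begin
    ⟦ suc m ℤ.⊖ suc n ⟧ℤ                  ≡⟨ ≡.cong ⟦_⟧ℤ (ℤP.[1+m]⊖[1+n]≡m⊖n m n) ⟩
    ⟦ m ℤ.⊖ n ⟧ℤ                          ≈⟨ ⟦⟧ℤ-homo-⊖ m n ⟩
    m ·ℕ 1# - n ·ℕ 1#                       ≈⟨ sym (+-identityˡ _) ⟩
    0# + (m ·ℕ 1# - n ·ℕ 1#)                ≈⟨ +-congʳ (sym (-‿inverseʳ 1#)) ⟩
    (1# - 1#) + (m ·ℕ 1# - n ·ℕ 1#)         ≈⟨ interchange _ _ _ _ ⟩
    (1# + m ·ℕ 1#) + (- 1# + - (n ·ℕ 1#))   ≈⟨ +-congˡ (⁻¹-∙-comm _ _) ⟩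
    (1# + m ·ℕ 1#) - (1# + n ·ℕ 1#)         ∎

  ⟦⟧ℤ-homo-+ : ∀ i j → ⟦ i ℤ.+ j ⟧ℤ ≈ ⟦ i ⟧ℤ + ⟦ j ⟧ℤ
  ⟦⟧ℤ-homo-+ -[1+ m ] -[1+ n ] = begin
    - (suc (suc (m ℕ.+ n)) ·ℕ 1#)      ≡⟨ ≡.cong (λ k → - (suc k ·ℕ 1#)) (≡.sym (ℕP.+-suc m n)) ⟩
    - ((suc m ℕ.+ suc n) ·ℕ 1#)        ≈⟨ -‿cong (×-homo-+ 1# (suc m) (suc n)) ⟩
    - (suc m ·ℕ 1# + suc n ·ℕ 1#)       ≈⟨ sym (⁻¹-∙-comm _ _) ⟩
    - (suc m ·ℕ 1#) + - (suc n ·ℕ 1#)   ∎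
  ⟦⟧ℤ-homo-+ -[1+ m ] (+ n)    = trans (⟦⟧ℤ-homo-⊖ n (suc m)) (+-comm _ _)
  ⟦⟧ℤ-homo-+ (+ m)    -[1+ n ] = ⟦⟧ℤ-homo-⊖ m (suc n)
  ⟦⟧ℤ-homo-+ (+ m)    (+ n)    = ×-homo-+ 1# m n

  ⟦⟧ℤ-homo-*⁺ : ∀ m j → ⟦ + m ℤ.* j ⟧ℤ ≈ ⟦ + m ⟧ℤ * ⟦ j ⟧ℤ
  ⟦⟧ℤ-homo-*⁺ m (+ n)    = ≡.subst (λ k → ⟦ k ⟧ℤ ≈ m ·ℕ 1# * n ·ℕ 1#) (ℤP.pos-* m n) (×1-homo-* m n)
  ⟦⟧ℤ-homo-*⁺ m -[1+ n ] = begin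
    ⟦ + m ℤ.* -[1+ n ] ⟧ℤ          ≡⟨ ≡.cong ⟦_⟧ℤ (≡.sym (ℤP.neg-distribʳ-* (+ m) (+ suc n))) ⟩
    ⟦ ℤ.- (+ m ℤ.* + suc n) ⟧ℤ     ≈⟨ ⟦⟧ℤ-homo-neg (+ m ℤ.* + suc n) ⟩
    - ⟦ + m ℤ.* + suc n ⟧ℤ         ≈⟨ -‿cong (⟦⟧ℤ-homo-*⁺ m (+ suc n)) ⟩
    - (⟦ + m ⟧ℤ * ⟦ + suc n ⟧ℤ)    ≈⟨ -‿distribʳ-* _ _ ⟩
    ⟦ + m ⟧ℤ * ⟦ -[1+ n ] ⟧ℤ       ∎

  ⟦⟧ℤ-homo-* : ∀ i j → ⟦ i ℤ.* j ⟧ℤ ≈ ⟦ i ⟧ℤ * ⟦ j ⟧ℤ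
  ⟦⟧ℤ-homo-* (+ m)    j = ⟦⟧ℤ-homo-*⁺ m j
  ⟦⟧ℤ-homo-* -[1+ m ] j = begin
    ⟦ -[1+ m ] ℤ.* j ⟧ℤ        ≡⟨ ≡.cong ⟦_⟧ℤ (≡.sym (ℤP.neg-distribˡ-* (+ suc m) j)) ⟩
    ⟦ ℤ.- (+ suc m ℤ.* j) ⟧ℤ   ≈⟨ ⟦⟧ℤ-homo-neg (+ suc m ℤ.* j) ⟩
    - ⟦ + suc m ℤ.* j ⟧ℤ       ≈⟨ -‿cong (⟦⟧ℤ-homo-*⁺ (suc m) j) ⟩
    - (⟦ + suc m ⟧ℤ * ⟦ j ⟧ℤ)  ≈⟨ -‿distribˡ-* _ _ ⟩
    ⟦ -[1+ m ] ⟧ℤ * ⟦ j ⟧ℤ     ∎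

  private
    ℤ-rawRing : RawRing _ _
    ℤ-rawRing = record
      { Carrier = ℤ ; _≈_ = _≡_ ; _+_ = ℤ._+_ ; _*_ = ℤ._*_ ; -_ = ℤ.-_ ; 0# = + 0 ; 1# = + 1 }

    ⟦⟧ℤ-morphism : ℤ-rawRing -Raw-AlmostCommutative⟶ fromCommutativeRing R
    ⟦⟧ℤ-morphism = record
      { ⟦_⟧ = ⟦_⟧ℤ ; +-homo = ⟦⟧ℤ-homo-+ ; *-homo = ⟦⟧ℤ-homo-* ; -‿homo = ⟦⟧ℤ-homo-neg
      ; 0-homo = refl ; 1-homo = +-identityʳ 1# }

    ⟦⟧ℤ-≟ : ∀ i j → Maybe (⟦ i ⟧ℤ ≈ ⟦ j ⟧ℤ)
    ⟦⟧ℤ-≟ i j with i ℤ.≟ j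
    ... | yes ≡.refl = just refl
    ... | no _       = nothing

  open import Algebra.Solver.Ring ℤ-rawRing (fromCommutativeRing R) ⟦⟧ℤ-morphism ⟦⟧ℤ-≟ public
    using (solve; _:=_; _:+_; _:*_; :-_; _:-_; con)

module Coefficients {c ℓ} (F : Field c ℓ) where
  open Data.List using (_++_)
  open Field F hiding (zero)
  open Polynomials F
  open import Algebra.Properties.Ring ring using (-0#≈0#; -‿+-comm)
  open import Algebra.Properties.CommutativeSemigroup +-commutativeSemigroup using (interchange)
  open import Relation.Binary.Reasoning.Setoid setoid

  select : Bool → Carrier → Carrier
  select b x = if b then x else 0#

  select-cong : ∀ b {x y} → x ≈ y → select b x ≈ select b y
  select-cong true  x≈y = x≈y
  select-cong false _   = refl

  select-+ : ∀ b x y → select b x + select b y ≈ select b (x + y)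
  select-+ true  x y = refl
  select-+ false x y = +-identityˡ 0#

  select-*ˡ : ∀ b a x → a * select b x ≈ select b (a * x)
  select-*ˡ true  a x = refl
  select-*ˡ false a x = zeroʳ a

  select-neg : ∀ b x → - select b x ≈ select b (- x)
  select-neg true  x = refl
  select-neg false x = -0#≈0#

  select-0# : ∀ b {x} → x ≈ 0# → select b x ≈ 0#
  select-0# true  x≈0 = x≈0
  select-0# false _   = refl

  coeff-++ : ∀ {m} (p q : Poly m) e → coeff (p ++ q) e ≈ coeff p e + coeff q e
  coeff-++ []      q e = sym (+-identityˡ _)
  coeff-++ (t ∷ p) q e = trans (+-congˡ (coeff-++ p q e)) (sym (+-assoc _ _ _))

  coeff-++-[] : ∀ {m} (p : Poly m) e → coeff (p ++ []) e ≈ coeff p e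
  coeff-++-[] p e = trans (coeff-++ p [] e) (+-identityʳ _)

  coeff-negₚ : ∀ {m} (p : Poly m) e → coeff (-ₚ p) e ≈ - coeff p e
  coeff-negₚ []            e = sym -0#≈0#
  coeff-negₚ ((a , f) ∷ p) e =
    trans (+-cong (sym (select-neg ⌊ f ≟ₘ e ⌋ a)) (coeff-negₚ p e)) (-‿+-comm _ _)

  coeff-·ₚ : ∀ {m} a (p : Poly m) e → coeff (a ·ₚ p) e ≈ a * coeff p e
  coeff-·ₚ a []            e = sym (zeroʳ a)
  coeff-·ₚ a ((b , f) ∷ p) e =
    trans (+-cong (sym (select-*ˡ ⌊ f ≟ₘ e ⌋ a b)) (coeff-·ₚ a p e)) (sym (distribˡ a _ _))

  coeff-map-·ˡ : ∀ {m a′} {A : Set a′} (ts : List A) (α β : A → Carrier) (mono : A → Mono m) a e →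
    (∀ t → α t ≈ a * β t) →
    coeff (List.map (λ t → (α t , mono t)) ts) e ≈ a * coeff (List.map (λ t → (β t , mono t)) ts) e
  coeff-map-·ˡ []       α β mono a e α≈aβ = sym (zeroʳ a)
  coeff-map-·ˡ (t ∷ ts) α β mono a e α≈aβ = trans
    (+-cong (trans (select-cong ⌊ mono t ≟ₘ e ⌋ (α≈aβ t)) (sym (select-*ˡ ⌊ mono t ≟ₘ e ⌋ a (β t))))
            (coeff-map-·ˡ ts α β mono a e α≈aβ))
    (sym (distribˡ a _ _))

  coeff-·ₚ-*ₚ : ∀ {m} a (g q : Poly m) e → coeff ((a ·ₚ g) *ₚ q) e ≈ a * coeff (g *ₚ q) e
  coeff-·ₚ-*ₚ a []            q e = sym (zeroʳ a)
  coeff-·ₚ-*ₚ a ((s , f) ∷ g) q e = begin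
    coeff (s′q ++ ((a ·ₚ g) *ₚ q)) e             ≈⟨ coeff-++ s′q _ e ⟩
    coeff s′q e + coeff ((a ·ₚ g) *ₚ q) e        ≈⟨ +-cong (coeff-map-·ˡ q _ _ _ a e (λ _ → *-assoc _ _ _))
                                                           (coeff-·ₚ-*ₚ a g q e) ⟩
    a * coeff sq e + a * coeff (g *ₚ q) e        ≈⟨ sym (distribˡ a _ _) ⟩
    a * (coeff sq e + coeff (g *ₚ q) e)          ≈⟨ *-congˡ (sym (coeff-++ sq (g *ₚ q) e)) ⟩
    a * coeff (((s , f) ∷ g) *ₚ q) e             ∎
    where
    s′q sq : Poly _
    s′q = List.map (λ t → ((a * s) * proj₁ t , Vec.zipWith ℕ._+_ f (proj₂ t))) q
    sq  = List.map (λ t → (s * proj₁ t , Vec.zipWith ℕ._+_ f (proj₂ t))) q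

  coeff-++-*ₚ : ∀ {m} (g g′ q : Poly m) e → coeff ((g ++ g′) *ₚ q) e ≈ coeff (g *ₚ q) e + coeff (g′ *ₚ q) e
  coeff-++-*ₚ g g′ q e =
    ≡.subst (λ r → coeff r e ≈ coeff (g *ₚ q) e + coeff (g′ *ₚ q) e)
      (≡.sym (ListP.concatMap-++ (λ s → List.map (λ t →
        (proj₁ s * proj₁ t , Vec.zipWith ℕ._+_ (proj₂ s) (proj₂ t))) q) g g′))
      (coeff-++ (g *ₚ q) (g′ *ₚ q) e)

  terms : ∀ {k m} → (Fin k → Carrier) → (Fin k → Mono m) → Poly m
  terms α mono = List.tabulate (λ v → (α v , mono v))

  coeff-terms-+ : ∀ {k m} (α β : Fin k → Carrier) (mono : Fin k → Mono m) e →
    coeff (terms α mono) e + coeff (terms β mono) e ≈ coeff (terms (λ v → α v + β v) mono) e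
  coeff-terms-+ {zero}  α β mono e = +-identityˡ 0#
  coeff-terms-+ {suc k} α β mono e = trans (interchange _ _ _ _)
    (+-cong (select-+ ⌊ mono zero ≟ₘ e ⌋ _ _)
            (coeff-terms-+ (λ v → α (suc v)) (λ v → β (suc v)) (λ v → mono (suc v)) e))

  coeff-terms-0# : ∀ {k m} {α : Fin k → Carrier} (mono : Fin k → Mono m) e →
    (∀ v → α v ≈ 0#) → coeff (terms α mono) e ≈ 0#
  coeff-terms-0# {zero}  mono e α≈0 = refl
  coeff-terms-0# {suc k} mono e α≈0 = trans
    (+-cong (select-0# ⌊ mono zero ≟ₘ e ⌋ (α≈0 zero))
            (coeff-terms-0# (λ v → mono (suc v)) e (λ v → α≈0 (suc v))))
    (+-identityˡ 0#)

  coeff-terms-δ : ∀ {k m} {α : Fin k → Carrier} (mono : Fin k → Mono m) e u →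
    α u ≈ 1# → (∀ v → v ≢ u → α v ≈ 0#) → coeff (terms α mono) e ≈ coeff ((1# , mono u) ∷ []) e
  coeff-terms-δ {suc k} mono e zero    αu≈1 α≈0 = +-cong (select-cong ⌊ mono zero ≟ₘ e ⌋ αu≈1)
    (coeff-terms-0# (λ v → mono (suc v)) e (λ v → α≈0 (suc v) (λ ())))
  coeff-terms-δ {suc k} mono e (suc u) αu≈1 α≈0 = trans
    (+-cong (select-0# ⌊ mono zero ≟ₘ e ⌋ (α≈0 zero (λ ())))
            (coeff-terms-δ (λ v → mono (suc v)) e u αu≈1
                           (λ v v≢u → α≈0 (suc v) (λ eq → v≢u (FinP.suc-injective eq)))))
    (+-identityˡ _)

  -ₚ-terms : ∀ {k m} (α : Fin k → Carrier) (mono : Fin k → Mono m) →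
    -ₚ terms α mono ≡ terms (λ v → - α v) mono
  -ₚ-terms α mono = ListP.map-tabulate _ _

  *ₚ-linPoly : ∀ {n} a (f : Mono n) (θ : Vec Carrier n) →
    ((a , f) ∷ []) *ₚ StanleyReisner.linPoly F θ ≡
    terms (λ v → a * lookup θ v) (λ v → Vec.zipWith ℕ._+_ f (unit v)) ++ []
  *ₚ-linPoly a f θ = ≡.cong (_++ []) (ListP.map-tabulate _ _)

module FieldProperties {c ℓ} (F : Field c ℓ) where
  open Field F hiding (zero)
  open import Algebra.Properties.Ring ring using (-0#≈0#; -‿involutive)
  open import Algebra.Properties.Group +-group using (x∙y⁻¹≈ε⇒x≈y)
  open ℤ-CoefficientSolver commutativeRing
  open import Relation.Binary.Reasoning.Setoid setoid

  *-≉0 : ∀ {x y} → ¬ x ≈ 0# → ¬ y ≈ 0# → ¬ x * y ≈ 0#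
  *-≉0 {x} {y} x≉0 y≉0 xy≈0 with inverse x x≉0
  ... | x⁻¹ , xx⁻¹≈1 = y≉0 (begin
    y                ≈⟨ sym (*-identityˡ y) ⟩
    1# * y           ≈⟨ *-congʳ (sym xx⁻¹≈1) ⟩
    (x * x⁻¹) * y    ≈⟨ solve 3 (λ x x⁻¹ y → (x :* x⁻¹) :* y := x⁻¹ :* (x :* y)) refl x x⁻¹ y ⟩
    x⁻¹ * (x * y)    ≈⟨ *-congˡ xy≈0 ⟩
    x⁻¹ * 0#         ≈⟨ zeroʳ x⁻¹ ⟩
    0#               ∎)

  x≉0⇒-x≉0 : ∀ {x} → ¬ x ≈ 0# → ¬ - x ≈ 0#
  x≉0⇒-x≉0 {x} x≉0 -x≈0 = x≉0 (trans (sym (-‿involutive x)) (trans (-‿cong -x≈0) -0#≈0#))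

  x≉y⇒x-y≉0 : ∀ {x y} → ¬ x ≈ y → ¬ x - y ≈ 0#
  x≉y⇒x-y≉0 {x} {y} x≉y x-y≈0 = x≉y (x∙y⁻¹≈ε⇒x≈y x y x-y≈0)

  left-inverse : ∀ x → ¬ x ≈ 0# → ∃ λ x⁻¹ → x⁻¹ * x ≈ 1#
  left-inverse x x≉0 with inverse x x≉0
  ... | x⁻¹ , xx⁻¹≈1 = x⁻¹ , trans (*-comm x⁻¹ x) xx⁻¹≈1

module Evaluation {c ℓ} (F : Field c ℓ) where
  open Data.List using (_++_)
  open Field F hiding (zero)
  open Polynomials F
  open FieldProperties F using (*-≉0)
  open ℤ-CoefficientSolver commutativeRing
  open import Algebra.Properties.Ring ring using (-0#≈0#; -‿+-comm; -‿distribˡ-*)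

  eval-++ : ∀ {k} (p q : Poly k) x → eval (p ++ q) x ≈ eval p x + eval q x
  eval-++ []      q x = sym (+-identityˡ _)
  eval-++ (t ∷ p) q x = trans (+-congˡ (eval-++ p q x)) (sym (+-assoc _ _ _))

  eval-negₚ : ∀ {k} (p : Poly k) x → eval (-ₚ p) x ≈ - eval p x
  eval-negₚ []      x = sym -0#≈0#
  eval-negₚ (t ∷ p) x = trans (+-cong (sym (-‿distribˡ-* _ _)) (eval-negₚ p x)) (-‿+-comm _ _)

  ^-+ : ∀ x a b → x ^ (a ℕ.+ b) ≈ (x ^ a) * (x ^ b)
  ^-+ x zero    b = sym (*-identityˡ _)
  ^-+ x (suc a) b = trans (*-congˡ (^-+ x a b)) (sym (*-assoc _ _ _))

  evalMono-+ : ∀ {k} (x : Vec Carrier k) (e f : Mono k) →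
    evalMono x (Vec.zipWith ℕ._+_ e f) ≈ evalMono x e * evalMono x f
  evalMono-+ Vec.[]       Vec.[]       Vec.[]       = sym (*-identityˡ 1#)
  evalMono-+ (x Vec.∷ xs) (a Vec.∷ as) (b Vec.∷ bs) =
    trans (*-cong (^-+ x a b) (evalMono-+ xs as bs))
          (solve 4 (λ p q r s → (p :* q) :* (r :* s) := (p :* r) :* (q :* s)) refl _ _ _ _)

  eval-*ₚ : ∀ {k} (p q : Poly k) x → eval (p *ₚ q) x ≈ eval p x * eval q x
  eval-*ₚ []            q x = sym (zeroˡ _)
  eval-*ₚ ((s , f) ∷ p) q x =
    trans (eval-++ (shifted q) (p *ₚ q) x)
          (trans (+-cong (eval-shifted q) (eval-*ₚ p q x)) (sym (distribʳ _ _ _)))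
    where
    shifted : Poly _ → Poly _
    shifted = List.map (λ t → (s * proj₁ t , Vec.zipWith ℕ._+_ f (proj₂ t)))
    eval-shifted : ∀ q → eval (shifted q) x ≈ (s * evalMono x f) * eval q x
    eval-shifted []            = sym (zeroʳ _)
    eval-shifted ((a , g) ∷ q) =
      trans (+-cong (*-congˡ (evalMono-+ x f g)) (eval-shifted q))
            (trans (+-congʳ (solve 4 (λ a b c d → (a :* b) :* (c :* d) := (a :* c) :* (b :* d)) refl _ _ _ _))
                   (sym (distribˡ _ _ _)))

  constₚ : ∀ {k} → Carrier → Poly k
  constₚ a = (a , tabulate (λ _ → 0)) ∷ []

  varₚ : ∀ {k} → Fin k → Poly k
  varₚ j = (1# , unit j) ∷ []

  evalMono-0 : ∀ {k} (x : Vec Carrier k) → evalMono x (tabulate (λ _ → 0)) ≈ 1#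
  evalMono-0 Vec.[]       = refl
  evalMono-0 (x Vec.∷ xs) = trans (*-identityˡ _) (evalMono-0 xs)

  eval-constₚ : ∀ {k} a (x : Vec Carrier k) → eval (constₚ a) x ≈ a
  eval-constₚ a x = trans (+-identityʳ _) (trans (*-congˡ (evalMono-0 x)) (*-identityʳ a))

  evalMono-unit : ∀ {k} (x : Vec Carrier k) j → evalMono x (unit j) ≈ lookup x j
  evalMono-unit (x Vec.∷ xs) zero    = trans (*-cong (*-identityʳ x) (evalMono-0 xs)) (*-identityʳ x)
  evalMono-unit (x Vec.∷ xs) (suc j) = trans (*-identityˡ _)
    (≡.subst (λ e → evalMono xs e ≈ lookup xs j)
             (VecP.tabulate-cong (λ i → unit-suc (j FinP.≟ i))) (evalMono-unit xs j))
    where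
    unit-suc : ∀ {i} (d : Dec (j ≡ i)) →
      (if ⌊ d ⌋ then 1 else 0) ≡ (if ⌊ map′ (≡.cong suc) FinP.suc-injective d ⌋ then 1 else 0)
    unit-suc (yes _) = ≡.refl
    unit-suc (no _)  = ≡.refl

  eval-varₚ : ∀ {k} (x : Vec Carrier k) j → eval (varₚ j) x ≈ lookup x j
  eval-varₚ x j = trans (+-identityʳ _) (trans (*-identityˡ _) (evalMono-unit x j))

  ∏ : ∀ {a k} {A : Set a} → (A → Poly k) → List A → Poly k
  ∏ f []       = constₚ 1#
  ∏ f (a ∷ as) = f a *ₚ ∏ f as

  eval-∏-≈0 : ∀ {a k} {A : Set a} (f : A → Poly k) {as : List A} {b} x →
    b Membership.∈ as → eval (f b) x ≈ 0# → eval (∏ f as) x ≈ 0#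
  eval-∏-≈0 f {a ∷ as} x (here ≡.refl) fb≈0 =
    trans (eval-*ₚ (f a) (∏ f as) x) (trans (*-congʳ fb≈0) (zeroˡ _))
  eval-∏-≈0 f {a ∷ as} x (there b∈as)  fb≈0 =
    trans (eval-*ₚ (f a) (∏ f as) x) (trans (*-congˡ (eval-∏-≈0 f x b∈as fb≈0)) (zeroʳ _))

  eval-∏-≉0 : ∀ {a k} {A : Set a} (f : A → Poly k) (as : List A) x →
    (∀ b → ¬ eval (f b) x ≈ 0#) → ¬ eval (∏ f as) x ≈ 0#
  eval-∏-≉0 f []       x f≉0 = λ 1≈0 → 1≉0 (trans (sym (eval-constₚ 1# x)) 1≈0)
  eval-∏-≉0 f (a ∷ as) x f≉0 =
    λ ≈0 → *-≉0 (f≉0 a) (eval-∏-≉0 f as x f≉0) (trans (sym (eval-*ₚ (f a) (∏ f as) x)) ≈0)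

  gate : ∀ {a k} {A : Set a} → Dec A → Poly k → Poly k
  gate (yes _) p = p
  gate (no _)  p = constₚ 1#

  eval-gate-≈0 : ∀ {a k} {A : Set a} (d : Dec A) (p : Poly k) x → A → eval p x ≈ 0# → eval (gate d p) x ≈ 0#
  eval-gate-≈0 (yes _) p x _ p≈0 = p≈0
  eval-gate-≈0 (no ¬a) p x a _   = ⊥-elim (¬a a)

  eval-gate-≉0 : ∀ {a k} {A : Set a} (d : Dec A) (p : Poly k) x → (A → ¬ eval p x ≈ 0#) → ¬ eval (gate d p) x ≈ 0#
  eval-gate-≉0 (yes a) p x p≉0 = p≉0 a
  eval-gate-≉0 (no _)  p x _   = λ 1≈0 → 1≉0 (trans (sym (eval-constₚ 1# x)) 1≈0)

module Ideal {c ℓ} (F : Field c ℓ) {n} (Δ : SimplicialComplex n) (θ₁ θ₂ θ₃ : Vec (Field.Carrier F) n) where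
  open Data.List using (_++_)
  open Field F hiding (zero)
  open Polynomials F
  open StanleyReisner F
  open Coefficients F
  open ℤ-CoefficientSolver commutativeRing
  open import Relation.Binary.Reasoning.Setoid setoid

  -- p ∈ I_Δ + (θ₁, θ₂, θ₃); a record so that p can be inferred from the type
  record _∈J (p : Poly n) : Set (c ⊔ ℓ) where
    constructor ∈J⁺
    field ∈J⁻ : InJ Δ θ₁ θ₂ θ₃ p
  open _∈J public

  Generators : Set c
  Generators = List (Poly n × Σ (Subset n) (λ S → ¬ Face Δ S))

  generated : Generators → Poly n
  generated = List.foldr (λ g acc → (proj₁ g *ₚ xSet (proj₁ (proj₂ g))) +ₚ acc) 0ₚ

  generated-++ : ∀ gs gs′ → generated (gs ++ gs′) ≡ generated gs ++ generated gs′
  generated-++ []       gs′ = ≡.refl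
  generated-++ (g ∷ gs) gs′ = ≡.trans (≡.cong (_ ++_) (generated-++ gs gs′))
    (≡.sym (ListP.++-assoc (proj₁ g *ₚ xSet (proj₁ (proj₂ g))) (generated gs) (generated gs′)))

  scaleGenerators : Carrier → Generators → Generators
  scaleGenerators a = List.map (λ g → (a ·ₚ proj₁ g , proj₂ g))

  coeff-scaleGenerators : ∀ a gs e → coeff (generated (scaleGenerators a gs)) e ≈ a * coeff (generated gs) e
  coeff-scaleGenerators a []             e = sym (zeroʳ a)
  coeff-scaleGenerators a ((g , S) ∷ gs) e = begin
    coeff (((a ·ₚ g) *ₚ xS) ++ generated (scaleGenerators a gs)) e
      ≈⟨ coeff-++ ((a ·ₚ g) *ₚ xS) _ e ⟩
    coeff ((a ·ₚ g) *ₚ xS) e + coeff (generated (scaleGenerators a gs)) e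
      ≈⟨ +-cong (coeff-·ₚ-*ₚ a g xS e) (coeff-scaleGenerators a gs e) ⟩
    a * coeff (g *ₚ xS) e + a * coeff (generated gs) e
      ≈⟨ sym (distribˡ a _ _) ⟩
    a * (coeff (g *ₚ xS) e + coeff (generated gs) e)
      ≈⟨ *-congˡ (sym (coeff-++ (g *ₚ xS) _ e)) ⟩
    a * coeff (generated ((g , S) ∷ gs)) e ∎
    where
    xS : Poly n
    xS = xSet (proj₁ S)

  InIΔ-++ : ∀ {h h′} → InIΔ Δ h → InIΔ Δ h′ → InIΔ Δ (h ++ h′)
  InIΔ-++ {h} {h′} (gs , h≐) (gs′ , h′≐) = gs ++ gs′ , λ e → begin
    coeff (h ++ h′) e                               ≈⟨ coeff-++ h h′ e ⟩
    coeff h e + coeff h′ e                          ≈⟨ +-cong (h≐ e) (h′≐ e) ⟩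
    coeff (generated gs) e + coeff (generated gs′) e ≈⟨ sym (coeff-++ (generated gs) _ e) ⟩
    coeff (generated gs ++ generated gs′) e         ≡⟨ ≡.cong (λ r → coeff r e) (≡.sym (generated-++ gs gs′)) ⟩
    coeff (generated (gs ++ gs′)) e                 ∎

  InIΔ-·ₚ : ∀ a {h} → InIΔ Δ h → InIΔ Δ (a ·ₚ h)
  InIΔ-·ₚ a {h} (gs , h≐) = scaleGenerators a gs , λ e →
    trans (coeff-·ₚ a h e) (trans (*-congˡ (h≐ e)) (sym (coeff-scaleGenerators a gs e)))

  Θ-combination : (g₁ g₂ g₃ h : Poly n) → Poly n
  Θ-combination g₁ g₂ g₃ h = (g₁ *ₚ linPoly θ₁) +ₚ ((g₂ *ₚ linPoly θ₂) +ₚ ((g₃ *ₚ linPoly θ₃) +ₚ h))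

  coeff-Θ-combination : ∀ g₁ g₂ g₃ h e → coeff (Θ-combination g₁ g₂ g₃ h) e ≈
    coeff (g₁ *ₚ linPoly θ₁) e + (coeff (g₂ *ₚ linPoly θ₂) e + (coeff (g₃ *ₚ linPoly θ₃) e + coeff h e))
  coeff-Θ-combination g₁ g₂ g₃ h e = trans (coeff-++ (g₁ *ₚ linPoly θ₁) _ e)
    (+-congˡ (trans (coeff-++ (g₂ *ₚ linPoly θ₂) _ e) (+-congˡ (coeff-++ (g₃ *ₚ linPoly θ₃) h e))))

  coeff-Θ-combination-++ : ∀ g₁ g₂ g₃ h g₁′ g₂′ g₃′ h′ e →
    coeff (Θ-combination (g₁ ++ g₁′) (g₂ ++ g₂′) (g₃ ++ g₃′) (h ++ h′)) e ≈
    coeff (Θ-combination g₁ g₂ g₃ h) e + coeff (Θ-combination g₁′ g₂′ g₃′ h′) e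
  coeff-Θ-combination-++ g₁ g₂ g₃ h g₁′ g₂′ g₃′ h′ e = begin
    coeff (Θ-combination (g₁ ++ g₁′) (g₂ ++ g₂′) (g₃ ++ g₃′) (h ++ h′)) e
      ≈⟨ coeff-Θ-combination (g₁ ++ g₁′) (g₂ ++ g₂′) (g₃ ++ g₃′) (h ++ h′) e ⟩
    _ ≈⟨ +-cong (coeff-++-*ₚ g₁ g₁′ _ e) (+-cong (coeff-++-*ₚ g₂ g₂′ _ e)
           (+-cong (coeff-++-*ₚ g₃ g₃′ _ e) (coeff-++ h h′ e))) ⟩
    _ ≈⟨ solve 8 (λ a a′ b b′ c c′ d d′ → (a :+ a′) :+ ((b :+ b′) :+ ((c :+ c′) :+ (d :+ d′)))
                    := (a :+ (b :+ (c :+ d))) :+ (a′ :+ (b′ :+ (c′ :+ d′)))) refl _ _ _ _ _ _ _ _ ⟩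
    _ ≈⟨ sym (+-cong (coeff-Θ-combination g₁ g₂ g₃ h e) (coeff-Θ-combination g₁′ g₂′ g₃′ h′ e)) ⟩
    coeff (Θ-combination g₁ g₂ g₃ h) e + coeff (Θ-combination g₁′ g₂′ g₃′ h′) e ∎

  coeff-Θ-combination-·ₚ : ∀ a g₁ g₂ g₃ h e →
    coeff (Θ-combination (a ·ₚ g₁) (a ·ₚ g₂) (a ·ₚ g₃) (a ·ₚ h)) e ≈ a * coeff (Θ-combination g₁ g₂ g₃ h) e
  coeff-Θ-combination-·ₚ a g₁ g₂ g₃ h e = begin
    coeff (Θ-combination (a ·ₚ g₁) (a ·ₚ g₂) (a ·ₚ g₃) (a ·ₚ h)) e
      ≈⟨ coeff-Θ-combination (a ·ₚ g₁) (a ·ₚ g₂) (a ·ₚ g₃) (a ·ₚ h) e ⟩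
    _ ≈⟨ +-cong (coeff-·ₚ-*ₚ a g₁ _ e) (+-cong (coeff-·ₚ-*ₚ a g₂ _ e)
           (+-cong (coeff-·ₚ-*ₚ a g₃ _ e) (coeff-·ₚ a h e))) ⟩
    _ ≈⟨ solve 5 (λ a x y z w → a :* x :+ (a :* y :+ (a :* z :+ a :* w))
                    := a :* (x :+ (y :+ (z :+ w)))) refl _ _ _ _ _ ⟩
    _ ≈⟨ *-congˡ (sym (coeff-Θ-combination g₁ g₂ g₃ h e)) ⟩
    a * coeff (Θ-combination g₁ g₂ g₃ h) e ∎

  ∈J-resp-≐ : ∀ {p q} → p ≐ q → q ∈J → p ∈J
  ∈J-resp-≐ p≐q (∈J⁺ (g₁ , g₂ , g₃ , h , h∈IΔ , q≐)) =
    ∈J⁺ (g₁ , g₂ , g₃ , h , h∈IΔ , λ e → trans (p≐q e) (q≐ e))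

  []∈J : [] ∈J
  []∈J = ∈J⁺ ([] , [] , [] , [] , ([] , λ _ → refl) , λ _ → refl)

  ∈J-++ : ∀ {p q} → p ∈J → q ∈J → (p ++ q) ∈J
  ∈J-++ {p} {q} (∈J⁺ (g₁ , g₂ , g₃ , h , h∈IΔ , p≐)) (∈J⁺ (g₁′ , g₂′ , g₃′ , h′ , h′∈IΔ , q≐)) = ∈J⁺ (
    g₁ ++ g₁′ , g₂ ++ g₂′ , g₃ ++ g₃′ , h ++ h′ , InIΔ-++ {h} {h′} h∈IΔ h′∈IΔ , λ e →
      trans (coeff-++ p q e) (trans (+-cong (p≐ e) (q≐ e))
        (sym (coeff-Θ-combination-++ g₁ g₂ g₃ h g₁′ g₂′ g₃′ h′ e))))

  ∈J-·ₚ : ∀ a {p} → p ∈J → (a ·ₚ p) ∈J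
  ∈J-·ₚ a {p} (∈J⁺ (g₁ , g₂ , g₃ , h , h∈IΔ , p≐)) = ∈J⁺ (
    a ·ₚ g₁ , a ·ₚ g₂ , a ·ₚ g₃ , a ·ₚ h , InIΔ-·ₚ a {h} h∈IΔ , λ e →
      trans (coeff-·ₚ a p e) (trans (*-congˡ (p≐ e)) (sym (coeff-Θ-combination-·ₚ a g₁ g₂ g₃ h e))))

  ∈J-negₚ : ∀ {p} → p ∈J → (-ₚ p) ∈J
  ∈J-negₚ {p} p∈J = ∈J-resp-≐ (λ e → trans (coeff-negₚ p e)
    (trans (sym (-1*x≈-x _)) (sym (coeff-·ₚ (- 1#) p e)))) (∈J-·ₚ (- 1#) p∈J)
    where open import Algebra.Properties.Ring ring using (-1*x≈-x)

  Θ-combination∈J : ∀ g₁ g₂ g₃ → Θ-combination g₁ g₂ g₃ [] ∈J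
  Θ-combination∈J g₁ g₂ g₃ = ∈J⁺ (g₁ , g₂ , g₃ , [] , ([] , λ _ → refl) , λ _ → refl)

  *ₚ-xSet∈J : ∀ S → ¬ Face Δ S → (g : Poly n) → (g *ₚ xSet S) ∈J
  *ₚ-xSet∈J S S∉Δ g = ∈J⁺ ([] , [] , [] , g *ₚ xSet S ,
    ((g , S , S∉Δ) ∷ [] , λ e → sym (coeff-++-[] (g *ₚ xSet S) e)) , λ _ → refl)

  monomial : Mono n → Poly n
  monomial e = (1# , e) ∷ []

  term-0#∈J : ∀ {a} (e : Mono n) → a ≈ 0# → ((a , e) ∷ []) ∈J
  term-0#∈J e a≈0 = ∈J-resp-≐ (λ f → trans (+-identityʳ _) (select-0# ⌊ e ≟ₘ f ⌋ a≈0)) []∈J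

  term∈J : ∀ a (e : Mono n) → monomial e ∈J → ((a , e) ∷ []) ∈J
  term∈J a e xᵉ∈J = ∈J-resp-≐ (λ f → +-congʳ (select-cong ⌊ e ≟ₘ f ⌋ (sym (*-identityʳ a))))
    (∈J-·ₚ a xᵉ∈J)

  terms∈J : ∀ {k} (α : Fin k → Carrier) (mono : Fin k → Mono n) →
    (∀ v → ((α v , mono v) ∷ []) ∈J) → terms α mono ∈J
  terms∈J {zero}  α mono _ = []∈J
  terms∈J {suc k} α mono each∈J =
    ∈J-++ (each∈J zero) (terms∈J (λ v → α (suc v)) (λ v → mono (suc v)) (λ v → each∈J (suc v)))

module Exponents {n : ℕ} where
  lower raise : Vec ℕ n → Fin n → Vec ℕ n
  lower e u = Vec.updateAt e u ℕ.pred
  raise e y = Vec.updateAt e y suc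

  shift : Vec ℕ n → Fin n → Fin n → Vec ℕ n
  shift e u y = raise (lower e u) y

  raise-lower : ∀ e u → 1 ≤ lookup e u → raise (lower e u) u ≡ e
  raise-lower e u 1≤eᵤ = ≡.trans (VecP.updateAt-updateAt u e)
    (VecP.updateAt-id-local u e (ℕP.suc-pred (lookup e u) ⦃ ℕ.>-nonZero 1≤eᵤ ⦄))

  lookup-shift-source : ∀ e {u y m} → y ≢ u → suc m ≤ lookup e u → m ≤ lookup (shift e u y) u
  lookup-shift-source e {u} {y} y≢u 1+m≤eᵤ = ≡.subst (_ ≤_)
    (≡.sym (≡.trans (VecP.lookup∘updateAt′ u y (λ u≡y → y≢u (≡.sym u≡y)) (lower e u)) (VecP.lookup∘updateAt u e)))
    (ℕP.pred-mono-≤ 1+m≤eᵤ)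

  lookup-shift-other : ∀ e {u i} y → i ≢ u → lookup e i ≤ lookup (shift e u y) i
  lookup-shift-other e {u} {i} y i≢u with y FinP.≟ i
  ... | yes ≡.refl = ℕP.≤-trans (ℕP.≤-reflexive (≡.sym (VecP.lookup∘updateAt′ i u i≢u e)))
                       (ℕP.≤-trans (ℕP.n≤1+n _) (ℕP.≤-reflexive (≡.sym (VecP.lookup∘updateAt i (lower e u)))))
  ... | no y≢i     = ℕP.≤-reflexive (≡.sym (≡.trans (VecP.lookup∘updateAt′ i y (λ i≡y → y≢i (≡.sym i≡y)) (lower e u))
                       (VecP.lookup∘updateAt′ i u i≢u e)))

  lookup-shift-target : ∀ e u y → 1 ≤ lookup (shift e u y) y
  lookup-shift-target e u y = ≡.subst (1 ≤_) (≡.sym (VecP.lookup∘updateAt y (lower e u))) (s≤s z≤n)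

module Exchange {c ℓ} (F : Field c ℓ) {n} (Δ : SimplicialComplex n) (θ₁ θ₂ θ₃ : Vec (Field.Carrier F) n) where
  open Data.List using (_++_)
  open Field F hiding (zero)
  open Polynomials F
  open StanleyReisner F using (linPoly)
  open Coefficients F
  open Ideal F Δ θ₁ θ₂ θ₃
  open Exponents
  open import Relation.Binary.Reasoning.Setoid setoid

  zipWith-+-unit : ∀ (e : Mono n) y → Vec.zipWith ℕ._+_ e (unit y) ≡ raise e y
  zipWith-+-unit e y = ≡.trans (≡.sym (VecP.tabulate∘lookup _))
    (≡.trans (VecP.tabulate-cong lookup-≡) (VecP.tabulate∘lookup _))
    where
    lookup-≡ : ∀ i → lookup (Vec.zipWith ℕ._+_ e (unit y)) i ≡ lookup (raise e y) i
    lookup-≡ i rewrite VecP.lookup-zipWith ℕ._+_ i e (unit y)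
                     | VecP.lookup∘tabulate (λ j → if ⌊ y FinP.≟ j ⌋ then 1 else 0) i
      with y FinP.≟ i
    ... | yes ≡.refl = ≡.trans (ℕP.+-comm _ 1) (≡.sym (VecP.lookup∘updateAt y e))
    ... | no y≢i     = ≡.trans (ℕP.+-identityʳ _) (≡.sym (VecP.lookup∘updateAt′ i y (λ i≡y → y≢i (≡.sym i≡y)) e))

  Θ-form : Carrier → Carrier → Carrier → Fin n → Carrier
  Θ-form c₁ c₂ c₃ v = c₁ * lookup θ₁ v + (c₂ * lookup θ₂ v + c₃ * lookup θ₃ v)

  coeff-Θ-combination-monomial : ∀ c₁ c₂ c₃ (e : Mono n) f →
    coeff (Θ-combination ((c₁ , e) ∷ []) ((c₂ , e) ∷ []) ((c₃ , e) ∷ []) []) f ≈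
    coeff (terms (Θ-form c₁ c₂ c₃) (λ v → Vec.zipWith ℕ._+_ e (unit v))) f
  coeff-Θ-combination-monomial c₁ c₂ c₃ e f = begin
    coeff (Θ-combination ((c₁ , e) ∷ []) ((c₂ , e) ∷ []) ((c₃ , e) ∷ []) []) f
      ≈⟨ coeff-Θ-combination ((c₁ , e) ∷ []) ((c₂ , e) ∷ []) ((c₃ , e) ∷ []) [] f ⟩
    coeff (((c₁ , e) ∷ []) *ₚ linPoly θ₁) f + (coeff (((c₂ , e) ∷ []) *ₚ linPoly θ₂) f
      + (coeff (((c₃ , e) ∷ []) *ₚ linPoly θ₃) f + 0#))
      ≈⟨ +-cong (coeff-θ c₁ θ₁) (+-cong (coeff-θ c₂ θ₂) (trans (+-identityʳ _) (coeff-θ c₃ θ₃))) ⟩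
    coeff (terms (λ v → c₁ * lookup θ₁ v) mono) f + (coeff (terms (λ v → c₂ * lookup θ₂ v) mono) f
      + coeff (terms (λ v → c₃ * lookup θ₃ v) mono) f)
      ≈⟨ +-congˡ (coeff-terms-+ _ _ mono f) ⟩
    _ ≈⟨ coeff-terms-+ _ _ mono f ⟩
    coeff (terms (Θ-form c₁ c₂ c₃) mono) f ∎
    where
    mono : Fin n → Mono n
    mono v = Vec.zipWith ℕ._+_ e (unit v)
    coeff-θ : ∀ a θ → coeff (((a , e) ∷ []) *ₚ linPoly θ) f ≈ coeff (terms (λ v → a * lookup θ v) mono) f
    coeff-θ a θ rewrite *ₚ-linPoly a e θ = coeff-++-[] (terms (λ v → a * lookup θ v) mono) f

  module _ (c₁ c₂ c₃ : Carrier) (e : Mono n) (u : Fin n) where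
    private
      L : Fin n → Carrier
      L = Θ-form c₁ c₂ c₃
      e′ : Mono n
      e′ = lower e u
      mono : Fin n → Mono n
      mono y = Vec.zipWith ℕ._+_ e′ (unit y)
      ρ : Fin n → Carrier
      ρ y = if ⌊ y FinP.≟ u ⌋ then 0# else L y

    remainder : Poly n
    remainder = terms ρ mono

    Θ-part : Poly n
    Θ-part = Θ-combination ((c₁ , e′) ∷ []) ((c₂ , e′) ∷ []) ((c₃ , e′) ∷ []) []

    exchange-identity : 1 ≤ lookup e u → L u ≈ 1# → monomial e ≐ (Θ-part ++ (-ₚ remainder))
    exchange-identity 1≤eᵤ Lᵤ≈1 f = sym (begin
      coeff (Θ-part ++ (-ₚ remainder)) f
        ≈⟨ coeff-++ Θ-part (-ₚ remainder) f ⟩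
      coeff Θ-part f + coeff (-ₚ remainder) f
        ≈⟨ +-cong (coeff-Θ-combination-monomial c₁ c₂ c₃ e′ f)
                  (reflexive (≡.cong (λ r → coeff r f) (-ₚ-terms ρ mono))) ⟩
      coeff (terms L mono) f + coeff (terms (λ v → - ρ v) mono) f
        ≈⟨ coeff-terms-+ L _ mono f ⟩
      coeff (terms (λ v → L v + - ρ v) mono) f
        ≈⟨ coeff-terms-δ mono f u (L-ρ-at-u (u FinP.≟ u)) (λ v → L-ρ-off-u (v FinP.≟ u)) ⟩
      coeff (monomial (mono u)) f
        ≡⟨ ≡.cong (λ g → coeff (monomial g) f) (≡.trans (zipWith-+-unit e′ u) (raise-lower e u 1≤eᵤ)) ⟩
      coeff (monomial e) f ∎)
      where
      open import Algebra.Properties.Ring ring using (-0#≈0#)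
      L-ρ-at-u : (u≟u : Dec (u ≡ u)) → L u + - (if ⌊ u≟u ⌋ then 0# else L u) ≈ 1#
      L-ρ-at-u (yes _)  = trans (+-congˡ -0#≈0#) (trans (+-identityʳ _) Lᵤ≈1)
      L-ρ-at-u (no u≢u) = ⊥-elim (u≢u ≡.refl)
      L-ρ-off-u : ∀ {v} (v≟u : Dec (v ≡ u)) → v ≢ u → L v + - (if ⌊ v≟u ⌋ then 0# else L v) ≈ 0#
      L-ρ-off-u (yes v≡u) v≢u = ⊥-elim (v≢u v≡u)
      L-ρ-off-u (no _)    _   = -‿inverseʳ _

    remainder∈J : (∀ y → y ≢ u → L y ≈ 0# ⊎ monomial (shift e u y) ∈J) → remainder ∈J
    remainder∈J others = terms∈J ρ mono (λ y → term∈J′ y (y FinP.≟ u))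
      where
      term∈J′ : ∀ y (y≟u : Dec (y ≡ u)) → (((if ⌊ y≟u ⌋ then 0# else L y) , mono y) ∷ []) ∈J
      term∈J′ y (yes _) = term-0#∈J (mono y) refl
      term∈J′ y (no y≢u) with others y y≢u
      ... | inj₁ Ly≈0  = term-0#∈J (mono y) Ly≈0
      ... | inj₂ xʸ∈J =
        term∈J (L y) (mono y) (≡.subst (λ g → monomial g ∈J) (≡.sym (zipWith-+-unit e′ y)) xʸ∈J)

  exchange : ∀ c₁ c₂ c₃ e u → 1 ≤ lookup e u → Θ-form c₁ c₂ c₃ u ≈ 1# →
    (∀ y → y ≢ u → Θ-form c₁ c₂ c₃ y ≈ 0# ⊎ monomial (shift e u y) ∈J) → monomial e ∈J
  exchange c₁ c₂ c₃ e u 1≤eᵤ Lᵤ≈1 others = ∈J-resp-≐ (exchange-identity c₁ c₂ c₃ e u 1≤eᵤ Lᵤ≈1)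
    (∈J-++ (Θ-combination∈J ((c₁ , e′) ∷ []) ((c₂ , e′) ∷ []) ((c₃ , e′) ∷ []))
           (∈J-negₚ (remainder∈J c₁ c₂ c₃ e u others)))
    where
    e′ : Mono n
    e′ = lower e u

module Determinants {c ℓ} (F : Field c ℓ) where
  open Field F hiding (zero)
  open ℤ-CoefficientSolver commutativeRing

  det₂ : Carrier → Carrier → Carrier → Carrier → Carrier
  det₂ a₁ a₂ b₁ b₂ = a₁ * b₂ - a₂ * b₁

  det₃ : Carrier → Carrier → Carrier → Carrier → Carrier → Carrier → Carrier → Carrier → Carrier → Carrier
  det₃ a₁ a₂ a₃ b₁ b₂ b₃ c₁ c₂ c₃ = a₁ * det₂ b₂ b₃ c₂ c₃ + (a₂ * det₂ b₃ b₁ c₃ c₁ + a₃ * det₂ b₁ b₂ c₁ c₂)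

  det₂-cong : ∀ {a₁ a₂ b₁ b₂ a₁′ a₂′ b₁′ b₂′} → a₁ ≈ a₁′ → a₂ ≈ a₂′ → b₁ ≈ b₁′ → b₂ ≈ b₂′ →
    det₂ a₁ a₂ b₁ b₂ ≈ det₂ a₁′ a₂′ b₁′ b₂′
  det₂-cong a₁ a₂ b₁ b₂ = +-cong (*-cong a₁ b₂) (-‿cong (*-cong a₂ b₁))

  det₃-cong : ∀ {a₁ a₂ a₃ b₁ b₂ b₃ c₁ c₂ c₃ a₁′ a₂′ a₃′ b₁′ b₂′ b₃′ c₁′ c₂′ c₃′} →
    a₁ ≈ a₁′ → a₂ ≈ a₂′ → a₃ ≈ a₃′ → b₁ ≈ b₁′ → b₂ ≈ b₂′ → b₃ ≈ b₃′ → c₁ ≈ c₁′ → c₂ ≈ c₂′ → c₃ ≈ c₃′ →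
    det₃ a₁ a₂ a₃ b₁ b₂ b₃ c₁ c₂ c₃ ≈ det₃ a₁′ a₂′ a₃′ b₁′ b₂′ b₃′ c₁′ c₂′ c₃′
  det₃-cong a₁ a₂ a₃ b₁ b₂ b₃ c₁ c₂ c₃ =
    +-cong (*-cong a₁ (det₂-cong b₂ b₃ c₂ c₃))
      (+-cong (*-cong a₂ (det₂-cong b₃ b₁ c₃ c₁)) (*-cong a₃ (det₂-cong b₁ b₂ c₁ c₂)))

  det₂-repeated : ∀ a₁ a₂ → det₂ a₁ a₂ a₁ a₂ ≈ 0#
  det₂-repeated = solve 2 (λ a₁ a₂ → a₁ :* a₂ :- a₂ :* a₁ := con (+ 0)) refl

  det₃-repeated₁₂ : ∀ b₁ b₂ b₃ c₁ c₂ c₃ → det₃ b₁ b₂ b₃ b₁ b₂ b₃ c₁ c₂ c₃ ≈ 0#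
  det₃-repeated₁₂ = solve 6 (λ b₁ b₂ b₃ c₁ c₂ c₃ →
    b₁ :* (b₂ :* c₃ :- b₃ :* c₂) :+ (b₂ :* (b₃ :* c₁ :- b₁ :* c₃) :+ b₃ :* (b₁ :* c₂ :- b₂ :* c₁))
    := con (+ 0)) refl

  det₃-repeated₁₃ : ∀ b₁ b₂ b₃ c₁ c₂ c₃ → det₃ c₁ c₂ c₃ b₁ b₂ b₃ c₁ c₂ c₃ ≈ 0#
  det₃-repeated₁₃ = solve 6 (λ b₁ b₂ b₃ c₁ c₂ c₃ →
    c₁ :* (b₂ :* c₃ :- b₃ :* c₂) :+ (c₂ :* (b₃ :* c₁ :- b₁ :* c₃) :+ c₃ :* (b₁ :* c₂ :- b₂ :* c₁))
    := con (+ 0)) refl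

  det₃-expansion : ∀ k a₁ a₂ a₃ b₁ b₂ b₃ c₁ c₂ c₃ →
    (k * det₂ b₂ b₃ c₂ c₃) * a₁ + ((k * det₂ b₃ b₁ c₃ c₁) * a₂ + (k * det₂ b₁ b₂ c₁ c₂) * a₃)
      ≈ k * det₃ a₁ a₂ a₃ b₁ b₂ b₃ c₁ c₂ c₃
  det₃-expansion = solve 10 (λ k a₁ a₂ a₃ b₁ b₂ b₃ c₁ c₂ c₃ →
    (k :* (b₂ :* c₃ :- b₃ :* c₂)) :* a₁ :+ ((k :* (b₃ :* c₁ :- b₁ :* c₃)) :* a₂ :+ (k :* (b₁ :* c₂ :- b₂ :* c₁)) :* a₃)
    := k :* (a₁ :* (b₂ :* c₃ :- b₃ :* c₂) :+ (a₂ :* (b₃ :* c₁ :- b₁ :* c₃) :+ a₃ :* (b₁ :* c₂ :- b₂ :* c₁)))) refl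

  det₂-expansion : ∀ k a₁ a₂ a₃ b₂ b₃ →
    0# * a₁ + ((k * b₃) * a₂ + (k * - b₂) * a₃) ≈ k * det₂ a₂ a₃ b₂ b₃
  det₂-expansion = solve 6 (λ k a₁ a₂ a₃ b₂ b₃ →
    con (+ 0) :* a₁ :+ ((k :* b₃) :* a₂ :+ (k :* (:- b₂)) :* a₃) := k :* (a₂ :* b₃ :- a₃ :* b₂)) refl

  det₁-expansion : ∀ k a₁ a₂ a₃ → 0# * a₁ + (0# * a₂ + k * a₃) ≈ k * a₃
  det₁-expansion = solve 4 (λ k a₁ a₂ a₃ → con (+ 0) :* a₁ :+ (con (+ 0) :* a₂ :+ k :* a₃) := k :* a₃) refl

module Genericity {c ℓ} (F : Field c ℓ) {n} (π : Fin n → Color) where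
  open Field F hiding (zero)
  open Determinants F

  BothRed : Fin n → Fin n → Set
  BothRed u v = π u ≡ red × π v ≡ red

  red? : ∀ x → Dec (x ≡ red)
  red? blue = no (λ ())
  red? red  = yes ≡.refl

  bothRed? : ∀ u v → Dec (BothRed u v)
  bothRed? u v = red? (π u) ×-dec red? (π v)

  -- pairs and triples that can lie in a common face of a complex on which π is semi-proper
  Admissible₂ : Fin n → Fin n → Set
  Admissible₂ u v = u ≢ v × ¬ BothRed u v

  Admissible₃ : Fin n → Fin n → Fin n → Set
  Admissible₃ u v w = Admissible₂ u v × Admissible₂ u w × Admissible₂ v w

  admissible₂? : ∀ u v → Dec (Admissible₂ u v)
  admissible₂? u v = ¬? (u FinP.≟ v) ×-dec ¬? (bothRed? u v)

  admissible₃? : ∀ u v w → Dec (Admissible₃ u v w)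
  admissible₃? u v w = admissible₂? u v ×-dec (admissible₂? u w ×-dec admissible₂? v w)

  minor₂ : (θ₂ θ₃ : Vec Carrier n) → Fin n → Fin n → Carrier
  minor₂ θ₂ θ₃ u v = det₂ (lookup θ₂ u) (lookup θ₃ u) (lookup θ₂ v) (lookup θ₃ v)

  minor₃ : (θ₁ θ₂ θ₃ : Vec Carrier n) → Fin n → Fin n → Fin n → Carrier
  minor₃ θ₁ θ₂ θ₃ u v w = det₃ (lookup θ₁ u) (lookup θ₂ u) (lookup θ₃ u)
                               (lookup θ₁ v) (lookup θ₂ v) (lookup θ₃ v)
                               (lookup θ₁ w) (lookup θ₂ w) (lookup θ₃ w)

  record Generic (θ₁ θ₂ θ₃ : Vec Carrier n) : Set ℓ where
    field
      θ₃≉0     : ∀ u → ¬ lookup θ₃ u ≈ 0#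
      minor₂≉0 : ∀ {u v} → Admissible₂ u v → ¬ minor₂ θ₂ θ₃ u v ≈ 0#
      minor₃≉0 : ∀ {u v w} → Admissible₃ u v w → ¬ minor₃ θ₁ θ₂ θ₃ u v w ≈ 0#

length≤∣∣ : ∀ {n} {xs : List (Fin n)} {p : Subset n} → Unique xs → All (_∈ p) xs → length xs ≤ ∣ p ∣
length≤∣∣ []               []           = z≤n
length≤∣∣ (x≢xs ∷ unique) (x∈p ∷ xs∈p) =
  ℕP.≤-trans (s≤s (length≤∣∣ unique (∈-remove x≢xs xs∈p))) (x∈p⇒∣p-x∣<∣p∣ x∈p)
  where
  open import Data.Fin.Subset using (_-_)
  ∈-remove : ∀ {n x} {p : Subset n} {ys} → All (x ≢_) ys → All (_∈ p) ys → All (_∈ p - x) ys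
  ∈-remove []             []           = []
  ∈-remove (x≢y ∷ x≢ys) (y∈p ∷ ys∈p) = x∈p∧x≢y⇒x∈p-y y∈p (λ y≡x → x≢y (≡.sym y≡x)) ∷ ∈-remove x≢ys ys∈p

module HighPowers {c ℓ} (F : Field c ℓ) {n} (Δ : SimplicialComplex n) (π : Fin n → Color)
  (faces≤3 : ∀ S → Face Δ S → ∣ S ∣ ≤ 3) (semiProper : SemiProper Δ π)
  (θ₁ θ₂ θ₃ : Vec (Field.Carrier F) n) (generic : Genericity.Generic F π θ₁ θ₂ θ₃) where
  open Field F hiding (zero)
  open Polynomials F
  open Coefficients F
  open FieldProperties F using (left-inverse)
  open Determinants F
  open Genericity F π
  open Generic generic
  open Ideal F Δ θ₁ θ₂ θ₃
  open Exchange F Δ θ₁ θ₂ θ₃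
  open Exponents

  positive : ℕ → Bool
  positive zero    = false
  positive (suc _) = true

  support : Mono n → Subset n
  support = Vec.map positive

  ∈-support : ∀ e {i} → 1 ≤ lookup e i → i ∈ support e
  ∈-support e {i} 1≤eᵢ = VecP.lookup⇒[]= i (support e)
    (≡.trans (VecP.lookup-map i positive e) (positive-suc 1≤eᵢ))
    where
    positive-suc : ∀ {k} → 1 ≤ k → positive k ≡ true
    positive-suc (s≤s _) = ≡.refl

  pred+indicator : ∀ {k} (e : Mono k) →
    Vec.zipWith ℕ._+_ (Vec.map ℕ.pred e) (Vec.map (λ b → if b then 1 else 0) (Vec.map positive e)) ≡ e
  pred+indicator Vec.[]             = ≡.refl
  pred+indicator (zero  Vec.∷ e) = ≡.cong (zero Vec.∷_) (pred+indicator e)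
  pred+indicator (suc k Vec.∷ e) = ≡.cong₂ Vec._∷_ (ℕP.+-comm k 1) (pred+indicator e)

  ¬Face-support⇒∈J : ∀ e → ¬ Face Δ (support e) → monomial e ∈J
  ¬Face-support⇒∈J e S∉Δ = ∈J-resp-≐
    (λ f → ≡.subst (λ g → select ⌊ e ≟ₘ f ⌋ 1# + 0# ≈ select ⌊ g ≟ₘ f ⌋ (1# * 1#) + 0#)
                   (≡.sym (pred+indicator e)) (+-congʳ (select-cong ⌊ e ≟ₘ f ⌋ (sym (*-identityʳ 1#)))))
    (*ₚ-xSet∈J (support e) S∉Δ (monomial (Vec.map ℕ.pred e)))

  four-in-support⇒¬Face : ∀ e {a b c d} → 1 ≤ lookup e a → 1 ≤ lookup e b → 1 ≤ lookup e c → 1 ≤ lookup e d →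
    a ≢ b → a ≢ c → a ≢ d → b ≢ c → b ≢ d → c ≢ d → ¬ Face Δ (support e)
  four-in-support⇒¬Face e eₐ e_b e_c e_d a≢b a≢c a≢d b≢c b≢d c≢d S∈Δ = 4≰3 (ℕP.≤-trans
    (length≤∣∣ ((a≢b ∷ a≢c ∷ a≢d ∷ []) ∷ (b≢c ∷ b≢d ∷ []) ∷ (c≢d ∷ []) ∷ [] ∷ [])
               (∈-support e eₐ ∷ ∈-support e e_b ∷ ∈-support e e_c ∷ ∈-support e e_d ∷ []))
    (faces≤3 _ S∈Δ))
    where
    4≰3 : ¬ 4 ≤ 3
    4≰3 (s≤s (s≤s (s≤s ())))

  red-edge-in-support⇒¬Face : ∀ e {a b} → 1 ≤ lookup e a → 1 ≤ lookup e b → a ≢ b → BothRed a b →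
    ¬ Face Δ (support e)
  red-edge-in-support⇒¬Face e {a} {b} eₐ e_b a≢b bothRed S∈Δ =
    semiProper a b a≢b (downward Δ edge⊆support S∈Δ) bothRed
    where
    edge⊆support : (⁅ a ⁆ ∪ ⁅ b ⁆) ⊆ support e
    edge⊆support {z} z∈ab with x∈p∪q⁻ ⁅ a ⁆ ⁅ b ⁆ z∈ab
    ... | inj₁ z∈a = ≡.subst (_∈ support e) (≡.sym (x∈⁅y⁆⇒x≡y a z∈a)) (∈-support e eₐ)
    ... | inj₂ z∈b = ≡.subst (_∈ support e) (≡.sym (x∈⁅y⁆⇒x≡y b z∈b)) (∈-support e e_b)

  ≢-sym : ∀ {a b : Fin n} → a ≢ b → b ≢ a
  ≢-sym a≢b b≡a = a≢b (≡.sym b≡a)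

  1≤-of-≤ : ∀ {m k} → suc m ≤ k → 1 ≤ k
  1≤-of-≤ = ℕP.≤-trans (s≤s z≤n)

  -- The cofactors of the rows v and w give a linear form vanishing at v and w.
  u²vw∈J-admissible : ∀ e {u v w} → Admissible₃ u v w →
    2 ≤ lookup e u → 1 ≤ lookup e v → 1 ≤ lookup e w → monomial e ∈J
  u²vw∈J-admissible e {u} {v} {w} adm@((u≢v , _) , (u≢w , _) , (v≢w , _)) 2≤eᵤ 1≤eᵥ 1≤e_w
    with left-inverse _ (minor₃≉0 adm)
  ... | k , kD≈1 = exchange c₁ c₂ c₃ e u (1≤-of-≤ 2≤eᵤ) (trans (form≈kD u) kD≈1) others
    where
    θ₁⟨_⟩ θ₂⟨_⟩ θ₃⟨_⟩ : Fin n → Carrier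
    θ₁⟨ x ⟩ = lookup θ₁ x
    θ₂⟨ x ⟩ = lookup θ₂ x
    θ₃⟨ x ⟩ = lookup θ₃ x
    c₁ c₂ c₃ : Carrier
    c₁ = k * det₂ θ₂⟨ v ⟩ θ₃⟨ v ⟩ θ₂⟨ w ⟩ θ₃⟨ w ⟩
    c₂ = k * det₂ θ₃⟨ v ⟩ θ₁⟨ v ⟩ θ₃⟨ w ⟩ θ₁⟨ w ⟩
    c₃ = k * det₂ θ₁⟨ v ⟩ θ₂⟨ v ⟩ θ₁⟨ w ⟩ θ₂⟨ w ⟩
    form≈kD : ∀ x → Θ-form c₁ c₂ c₃ x ≈ k * minor₃ θ₁ θ₂ θ₃ x v w
    form≈kD x = det₃-expansion k θ₁⟨ x ⟩ θ₂⟨ x ⟩ θ₃⟨ x ⟩ θ₁⟨ v ⟩ θ₂⟨ v ⟩ θ₃⟨ v ⟩ θ₁⟨ w ⟩ θ₂⟨ w ⟩ θ₃⟨ w ⟩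
    others : ∀ y → y ≢ u → Θ-form c₁ c₂ c₃ y ≈ 0# ⊎ monomial (shift e u y) ∈J
    others y y≢u with y FinP.≟ v | y FinP.≟ w
    ... | yes ≡.refl | _          =
      inj₁ (trans (form≈kD y) (trans (*-congˡ (det₃-repeated₁₂ _ _ _ _ _ _)) (zeroʳ k)))
    ... | no _       | yes ≡.refl =
      inj₁ (trans (form≈kD y) (trans (*-congˡ (det₃-repeated₁₃ _ _ _ _ _ _)) (zeroʳ k)))
    ... | no y≢v     | no y≢w     = inj₂ (¬Face-support⇒∈J (shift e u y)
      (four-in-support⇒¬Face (shift e u y) (lookup-shift-source e y≢u 2≤eᵤ)
        (ℕP.≤-trans 1≤eᵥ (lookup-shift-other e y (≢-sym u≢v)))
        (ℕP.≤-trans 1≤e_w (lookup-shift-other e y (≢-sym u≢w)))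
        (lookup-shift-target e u y) u≢v u≢w (≢-sym y≢u) v≢w (≢-sym y≢v) (≢-sym y≢w)))

  u²vw∈J : ∀ e {u v w} → u ≢ v → u ≢ w → v ≢ w →
    2 ≤ lookup e u → 1 ≤ lookup e v → 1 ≤ lookup e w → monomial e ∈J
  u²vw∈J e {u} {v} {w} u≢v u≢w v≢w 2≤eᵤ 1≤eᵥ 1≤e_w with bothRed? u v | bothRed? u w | bothRed? v w
  ... | yes uv-red | _ | _ = ¬Face-support⇒∈J e (red-edge-in-support⇒¬Face e (1≤-of-≤ 2≤eᵤ) 1≤eᵥ u≢v uv-red)
  ... | _ | yes uw-red | _ = ¬Face-support⇒∈J e (red-edge-in-support⇒¬Face e (1≤-of-≤ 2≤eᵤ) 1≤e_w u≢w uw-red)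
  ... | _ | _ | yes vw-red = ¬Face-support⇒∈J e (red-edge-in-support⇒¬Face e 1≤eᵥ 1≤e_w v≢w vw-red)
  ... | no ¬uv-red | no ¬uw-red | no ¬vw-red =
    u²vw∈J-admissible e ((u≢v , ¬uv-red) , (u≢w , ¬uw-red) , (v≢w , ¬vw-red)) 2≤eᵤ 1≤eᵥ 1≤e_w

  u³v∈J-admissible : ∀ e {u v} → Admissible₂ u v → 3 ≤ lookup e u → 1 ≤ lookup e v → monomial e ∈J
  u³v∈J-admissible e {u} {v} adm@(u≢v , _) 3≤eᵤ 1≤eᵥ with left-inverse _ (minor₂≉0 adm)
  ... | k , kD≈1 = exchange 0# c₂ c₃ e u (1≤-of-≤ 3≤eᵤ) (trans (form≈kD u) kD≈1) others
    where
    c₂ c₃ : Carrier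
    c₂ = k * lookup θ₃ v
    c₃ = k * - lookup θ₂ v
    form≈kD : ∀ x → Θ-form 0# c₂ c₃ x ≈ k * minor₂ θ₂ θ₃ x v
    form≈kD x = det₂-expansion k (lookup θ₁ x) (lookup θ₂ x) (lookup θ₃ x) (lookup θ₂ v) (lookup θ₃ v)
    others : ∀ y → y ≢ u → Θ-form 0# c₂ c₃ y ≈ 0# ⊎ monomial (shift e u y) ∈J
    others y y≢u with y FinP.≟ v
    ... | yes ≡.refl = inj₁ (trans (form≈kD y) (trans (*-congˡ (det₂-repeated _ _)) (zeroʳ k)))
    ... | no y≢v     = inj₂ (u²vw∈J (shift e u y) u≢v (≢-sym y≢u) (≢-sym y≢v)
      (lookup-shift-source e y≢u 3≤eᵤ) (ℕP.≤-trans 1≤eᵥ (lookup-shift-other e y (≢-sym u≢v)))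
      (lookup-shift-target e u y))

  u³v∈J : ∀ e {u v} → u ≢ v → 3 ≤ lookup e u → 1 ≤ lookup e v → monomial e ∈J
  u³v∈J e {u} {v} u≢v 3≤eᵤ 1≤eᵥ with bothRed? u v
  ... | yes uv-red = ¬Face-support⇒∈J e (red-edge-in-support⇒¬Face e (1≤-of-≤ 3≤eᵤ) 1≤eᵥ u≢v uv-red)
  ... | no ¬uv-red = u³v∈J-admissible e (u≢v , ¬uv-red) 3≤eᵤ 1≤eᵥ

  u⁴∈J : ∀ e u → 4 ≤ lookup e u → monomial e ∈J
  u⁴∈J e u 4≤eᵤ with left-inverse _ (θ₃≉0 u)
  ... | k , kθ≈1 = exchange 0# 0# k e u (1≤-of-≤ 4≤eᵤ) (trans (form≈kθ u) kθ≈1) others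
    where
    form≈kθ : ∀ x → Θ-form 0# 0# k x ≈ k * lookup θ₃ x
    form≈kθ x = det₁-expansion k (lookup θ₁ x) (lookup θ₂ x) (lookup θ₃ x)
    others : ∀ y → y ≢ u → Θ-form 0# 0# k y ≈ 0# ⊎ monomial (shift e u y) ∈J
    others y y≢u = inj₂ (u³v∈J (shift e u y) (≢-sym y≢u) (lookup-shift-source e y≢u 4≤eᵤ)
      (lookup-shift-target e u y))

exponents≤3 : (k : ℕ) → List (Vec ℕ k)
exponents≤3 zero    = Vec.[] ∷ []
exponents≤3 (suc k) = List.cartesianProductWith Vec._∷_ (0 ∷ 1 ∷ 2 ∷ 3 ∷ []) (exponents≤3 k)

∈-exponents≤3⊎4≤ : ∀ {k} (e : Vec ℕ k) → e Membership.∈ exponents≤3 k ⊎ ∃ λ i → 4 ≤ lookup e i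
∈-exponents≤3⊎4≤ Vec.[] = inj₁ (here ≡.refl)
∈-exponents≤3⊎4≤ (d Vec.∷ e) with ∈-exponents≤3⊎4≤ e
... | inj₂ (i , 4≤eᵢ) = inj₂ (suc i , 4≤eᵢ)
... | inj₁ e∈ with d
...   | 0 = inj₁ (∈-cartesianProductWith⁺ Vec._∷_ {0 ∷ 1 ∷ 2 ∷ 3 ∷ []} (here ≡.refl) e∈)
...   | 1 = inj₁ (∈-cartesianProductWith⁺ Vec._∷_ {0 ∷ 1 ∷ 2 ∷ 3 ∷ []} (there (here ≡.refl)) e∈)
...   | 2 = inj₁ (∈-cartesianProductWith⁺ Vec._∷_ {0 ∷ 1 ∷ 2 ∷ 3 ∷ []} (there (there (here ≡.refl))) e∈)
...   | 3 = inj₁ (∈-cartesianProductWith⁺ Vec._∷_ {0 ∷ 1 ∷ 2 ∷ 3 ∷ []} (there (there (there (here ≡.refl)))) e∈)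
...   | suc (suc (suc (suc _))) = inj₂ (zero , s≤s (s≤s (s≤s (s≤s z≤n))))

module Spanning {c ℓ} (F : Field c ℓ) {n} (Δ : SimplicialComplex n) (θ₁ θ₂ θ₃ : Vec (Field.Carrier F) n) where
  open Data.List using (_++_)
  open Field F hiding (zero)
  open Polynomials F
  open StanleyReisner F using (FiniteDimQuotient)
  open Coefficients F
  open Ideal F Δ θ₁ θ₂ θ₃
  open ℤ-CoefficientSolver commutativeRing
  open import Algebra.Properties.Ring ring using (-0#≈0#)
  open import Relation.Binary.Reasoning.Setoid setoid

  span : (ms : List (Mono n)) → Vec Carrier (length ms) → Poly n
  span ms as = lincomb (Vec.toList as) (List.map monomial ms)

  coeff-span-0# : ∀ ms f → coeff (span ms (Vec.replicate _ 0#)) f ≈ 0#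
  coeff-span-0# []       f = refl
  coeff-span-0# (m ∷ ms) f = trans (coeff-++ (0# ·ₚ monomial m) (span ms (Vec.replicate _ 0#)) f)
    (trans (+-cong (trans (coeff-·ₚ 0# (monomial m) f) (zeroˡ _)) (coeff-span-0# ms f)) (+-identityʳ 0#))

  coeff-span-+ : ∀ ms (as bs : Vec Carrier (length ms)) f →
    coeff (span ms (Vec.zipWith _+_ as bs)) f ≈ coeff (span ms as) f + coeff (span ms bs) f
  coeff-span-+ []       Vec.[]       Vec.[]       f = sym (+-identityʳ 0#)
  coeff-span-+ (m ∷ ms) (a Vec.∷ as) (b Vec.∷ bs) f = begin
    coeff (((a + b) ·ₚ xᵐ) ++ span ms (Vec.zipWith _+_ as bs)) f
      ≈⟨ coeff-++ ((a + b) ·ₚ xᵐ) (span ms (Vec.zipWith _+_ as bs)) f ⟩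
    _ ≈⟨ +-cong (coeff-·ₚ (a + b) xᵐ f) (coeff-span-+ ms as bs f) ⟩
    (a + b) * coeff xᵐ f + (coeff (span ms as) f + coeff (span ms bs) f)
      ≈⟨ solve 5 (λ a b x y z → (a :+ b) :* x :+ (y :+ z) := (a :* x :+ y) :+ (b :* x :+ z)) refl a b _ _ _ ⟩
    (a * coeff xᵐ f + coeff (span ms as) f) + (b * coeff xᵐ f + coeff (span ms bs) f)
      ≈⟨ sym (+-cong (trans (coeff-++ (a ·ₚ xᵐ) (span ms as) f) (+-congʳ (coeff-·ₚ a xᵐ f)))
                     (trans (coeff-++ (b ·ₚ xᵐ) (span ms bs) f) (+-congʳ (coeff-·ₚ b xᵐ f)))) ⟩
    coeff (span (m ∷ ms) (a Vec.∷ as)) f + coeff (span (m ∷ ms) (b Vec.∷ bs)) f ∎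
    where
    xᵐ : Poly n
    xᵐ = monomial m

  indicator : ∀ {e} {ms : List (Mono n)} → e Membership.∈ ms → Carrier → Vec Carrier (length ms)
  indicator {ms = _ ∷ ms} (here _)  a = a Vec.∷ Vec.replicate (length ms) 0#
  indicator {ms = _ ∷ ms} (there e∈) a = 0# Vec.∷ indicator e∈ a

  coeff-span-indicator : ∀ {e ms} (e∈ms : e Membership.∈ ms) a f →
    coeff (span ms (indicator e∈ms a)) f ≈ coeff ((a , e) ∷ []) f
  coeff-span-indicator {e} {_ ∷ ms} (here ≡.refl) a f =
    trans (coeff-++ (a ·ₚ monomial e) (span ms (Vec.replicate (length ms) 0#)) f)
    (trans (+-cong (+-congʳ (select-cong ⌊ e ≟ₘ f ⌋ (*-identityʳ a))) (coeff-span-0# ms f)) (+-identityʳ _))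
  coeff-span-indicator {e} {m ∷ ms} (there e∈ms) a f =
    trans (coeff-++ (0# ·ₚ monomial m) (span ms (indicator e∈ms a)) f)
    (trans (+-cong (trans (coeff-·ₚ 0# (monomial m) f) (zeroˡ _)) (coeff-span-indicator e∈ms a f)) (+-identityˡ _))

  module _ (u⁴∈J : ∀ e u → 4 ≤ lookup e u → monomial e ∈J) where
    private
      ms : List (Mono n)
      ms = exponents≤3 n

    reduce : ∀ (p : Poly n) → ∃ λ (as : Vec Carrier (length ms)) → (p -ₚ span ms as) ∈J
    reduce [] = Vec.replicate _ 0# , ∈J-resp-≐ (λ f → trans (coeff-negₚ (span ms (Vec.replicate _ 0#)) f)
      (trans (-‿cong (coeff-span-0# ms f)) -0#≈0#)) []∈J
    reduce ((a , e) ∷ p) with reduce p | ∈-exponents≤3⊎4≤ e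
    ... | as , p-span∈J | inj₂ (u , 4≤eᵤ) = as , ∈J-++ (term∈J a e (u⁴∈J e u 4≤eᵤ)) p-span∈J
    ... | as , p-span∈J | inj₁ e∈ms      = as′ , ∈J-resp-≐ same-coeffs p-span∈J
      where
      as′ : Vec Carrier (length ms)
      as′ = Vec.zipWith _+_ as (indicator e∈ms a)
      same-coeffs : (((a , e) ∷ p) -ₚ span ms as′) ≐ (p -ₚ span ms as)
      same-coeffs f = begin
        select ⌊ e ≟ₘ f ⌋ a + coeff (p -ₚ span ms as′) f
          ≈⟨ +-congˡ (trans (coeff-++ p (-ₚ span ms as′) f) (+-congˡ (coeff-negₚ (span ms as′) f))) ⟩
        select ⌊ e ≟ₘ f ⌋ a + (coeff p f + - coeff (span ms as′) f)
          ≈⟨ +-congˡ (+-congˡ (-‿cong (trans (coeff-span-+ ms as _ f)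
               (+-congˡ (trans (coeff-span-indicator e∈ms a f) (+-identityʳ _)))))) ⟩
        select ⌊ e ≟ₘ f ⌋ a + (coeff p f + - (coeff (span ms as) f + select ⌊ e ≟ₘ f ⌋ a))
          ≈⟨ solve 3 (λ x y z → x :+ (y :+ :- (z :+ x)) := y :+ :- z) refl _ _ _ ⟩
        coeff p f + - coeff (span ms as) f
          ≈⟨ sym (trans (coeff-++ p (-ₚ span ms as) f) (+-congˡ (coeff-negₚ (span ms as) f))) ⟩
        coeff (p -ₚ span ms as) f ∎

    finiteDimQuotient : FiniteDimQuotient Δ θ₁ θ₂ θ₃
    finiteDimQuotient = List.map monomial ms , λ p →
      Vec.toList (proj₁ (reduce p)) , ∈J⁻ (proj₂ (reduce p))

module GenericityPolynomial {c ℓ} (F : Field c ℓ) {n} (π : Fin n → Color) where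
  open Field F hiding (zero)
  open Polynomials F
  open Evaluation F
  open FieldProperties F using (*-≉0)
  open Determinants F
  open Genericity F π

  K : ℕ
  K = n ℕ.+ (n ℕ.+ n)

  -- The 3n variables are laid out as the coefficients of θ₁, θ₂, θ₃, matching the point a₁ ++ a₂ ++ a₃.
  X₁ X₂ X₃ : Fin n → Poly K
  X₁ v = varₚ (v ↑ˡ (n ℕ.+ n))
  X₂ v = varₚ (n ↑ʳ (v ↑ˡ n))
  X₃ v = varₚ (n ↑ʳ (n ↑ʳ v))

  det₂ₚ : Poly K → Poly K → Poly K → Poly K → Poly K
  det₂ₚ a₁ a₂ b₁ b₂ = (a₁ *ₚ b₂) -ₚ (a₂ *ₚ b₁)

  det₃ₚ : Poly K → Poly K → Poly K → Poly K → Poly K → Poly K → Poly K → Poly K → Poly K → Poly K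
  det₃ₚ a₁ a₂ a₃ b₁ b₂ b₃ c₁ c₂ c₃ =
    (a₁ *ₚ det₂ₚ b₂ b₃ c₂ c₃) +ₚ ((a₂ *ₚ det₂ₚ b₃ b₁ c₃ c₁) +ₚ (a₃ *ₚ det₂ₚ b₁ b₂ c₁ c₂))

  minor₂ₚ : Fin n → Fin n → Poly K
  minor₂ₚ u v = det₂ₚ (X₂ u) (X₃ u) (X₂ v) (X₃ v)

  minor₃ₚ : Fin n → Fin n → Fin n → Poly K
  minor₃ₚ u v w = det₃ₚ (X₁ u) (X₂ u) (X₃ u) (X₁ v) (X₂ v) (X₃ v) (X₁ w) (X₂ w) (X₃ w)

  ∏ᵥ : (Fin n → Poly K) → Poly K
  ∏ᵥ f = ∏ f (List.allFin n)

  genericityPolynomial : Poly K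
  genericityPolynomial =
    ∏ᵥ X₃ *ₚ
    (∏ᵥ (λ u → ∏ᵥ (λ v → gate (admissible₂? u v) (minor₂ₚ u v))) *ₚ
     ∏ᵥ (λ u → ∏ᵥ (λ v → ∏ᵥ (λ w → gate (admissible₃? u v w) (minor₃ₚ u v w)))))

  module _ (x : Vec Carrier K) where
    eval-det₂ₚ : ∀ a₁ a₂ b₁ b₂ → eval (det₂ₚ a₁ a₂ b₁ b₂) x ≈ det₂ (eval a₁ x) (eval a₂ x) (eval b₁ x) (eval b₂ x)
    eval-det₂ₚ a₁ a₂ b₁ b₂ = trans (eval-++ (a₁ *ₚ b₂) _ x)
      (+-cong (eval-*ₚ a₁ b₂ x) (trans (eval-negₚ (a₂ *ₚ b₁) x) (-‿cong (eval-*ₚ a₂ b₁ x))))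

    eval-det₃ₚ : ∀ a₁ a₂ a₃ b₁ b₂ b₃ c₁ c₂ c₃ → eval (det₃ₚ a₁ a₂ a₃ b₁ b₂ b₃ c₁ c₂ c₃) x ≈
      det₃ (eval a₁ x) (eval a₂ x) (eval a₃ x) (eval b₁ x) (eval b₂ x) (eval b₃ x) (eval c₁ x) (eval c₂ x) (eval c₃ x)
    eval-det₃ₚ a₁ a₂ a₃ b₁ b₂ b₃ c₁ c₂ c₃ =
      trans (eval-++ (a₁ *ₚ det₂ₚ b₂ b₃ c₂ c₃) _ x) (+-cong (term a₁ b₂ b₃ c₂ c₃)
        (trans (eval-++ (a₂ *ₚ det₂ₚ b₃ b₁ c₃ c₁) _ x) (+-cong (term a₂ b₃ b₁ c₃ c₁) (term a₃ b₁ b₂ c₁ c₂))))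
      where
      term : ∀ a p q r s → eval (a *ₚ det₂ₚ p q r s) x ≈ eval a x * det₂ (eval p x) (eval q x) (eval r x) (eval s x)
      term a p q r s = trans (eval-*ₚ a (det₂ₚ p q r s) x) (*-congˡ (eval-det₂ₚ p q r s))

    eval-*ₚ-≈0ˡ : ∀ p q → eval p x ≈ 0# → eval (p *ₚ q) x ≈ 0#
    eval-*ₚ-≈0ˡ p q p≈0 = trans (eval-*ₚ p q x) (trans (*-congʳ p≈0) (zeroˡ _))

    eval-*ₚ-≈0ʳ : ∀ p q → eval q x ≈ 0# → eval (p *ₚ q) x ≈ 0#
    eval-*ₚ-≈0ʳ p q q≈0 = trans (eval-*ₚ p q x) (trans (*-congˡ q≈0) (zeroʳ _))

    eval-*ₚ-≉0 : ∀ p q → ¬ eval p x ≈ 0# → ¬ eval q x ≈ 0# → ¬ eval (p *ₚ q) x ≈ 0#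
    eval-*ₚ-≉0 p q p≉0 q≉0 pq≈0 = *-≉0 p≉0 q≉0 (trans (sym (eval-*ₚ p q x)) pq≈0)

    eval-∏ᵥ-≈0 : ∀ f u → eval (f u) x ≈ 0# → eval (∏ᵥ f) x ≈ 0#
    eval-∏ᵥ-≈0 f u = eval-∏-≈0 f x (∈-allFin u)

    eval-∏ᵥ-≉0 : ∀ f → (∀ u → ¬ eval (f u) x ≈ 0#) → ¬ eval (∏ᵥ f) x ≈ 0#
    eval-∏ᵥ-≉0 f = eval-∏-≉0 f (List.allFin n) x

  module _ (a₁ a₂ a₃ : Vec Carrier n) where
    private
      x : Vec Carrier K
      x = a₁ Vec.++ a₂ Vec.++ a₃
      ≡⇒≈ : ∀ {a b} → a ≡ b → a ≈ b
      ≡⇒≈ ≡.refl = refl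

    eval-X₁ : ∀ v → eval (X₁ v) x ≈ lookup a₁ v
    eval-X₁ v = trans (eval-varₚ x _) (≡⇒≈ (VecP.lookup-++ˡ a₁ (a₂ Vec.++ a₃) v))

    eval-X₂ : ∀ v → eval (X₂ v) x ≈ lookup a₂ v
    eval-X₂ v = trans (eval-varₚ x _)
      (≡⇒≈ (≡.trans (VecP.lookup-++ʳ a₁ (a₂ Vec.++ a₃) (v ↑ˡ n)) (VecP.lookup-++ˡ a₂ a₃ v)))

    eval-X₃ : ∀ v → eval (X₃ v) x ≈ lookup a₃ v
    eval-X₃ v = trans (eval-varₚ x _)
      (≡⇒≈ (≡.trans (VecP.lookup-++ʳ a₁ (a₂ Vec.++ a₃) (n ↑ʳ v)) (VecP.lookup-++ʳ a₂ a₃ v)))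

    eval-minor₂ₚ : ∀ u v → eval (minor₂ₚ u v) x ≈ minor₂ a₂ a₃ u v
    eval-minor₂ₚ u v = trans (eval-det₂ₚ x (X₂ u) (X₃ u) (X₂ v) (X₃ v))
      (det₂-cong (eval-X₂ u) (eval-X₃ u) (eval-X₂ v) (eval-X₃ v))

    eval-minor₃ₚ : ∀ u v w → eval (minor₃ₚ u v w) x ≈ minor₃ a₁ a₂ a₃ u v w
    eval-minor₃ₚ u v w = trans (eval-det₃ₚ x (X₁ u) (X₂ u) (X₃ u) (X₁ v) (X₂ v) (X₃ v) (X₁ w) (X₂ w) (X₃ w))
      (det₃-cong (eval-X₁ u) (eval-X₂ u) (eval-X₃ u) (eval-X₁ v) (eval-X₂ v) (eval-X₃ v)
                 (eval-X₁ w) (eval-X₂ w) (eval-X₃ w))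

    private
      P₁ P₂ P₃ : Poly K
      P₁ = ∏ᵥ X₃
      P₂ = ∏ᵥ (λ u → ∏ᵥ (λ v → gate (admissible₂? u v) (minor₂ₚ u v)))
      P₃ = ∏ᵥ (λ u → ∏ᵥ (λ v → ∏ᵥ (λ w → gate (admissible₃? u v w) (minor₃ₚ u v w))))

    eval≉0⇒Generic : ¬ eval genericityPolynomial x ≈ 0# → Generic a₁ a₂ a₃
    eval≉0⇒Generic P≉0 = record
      { θ₃≉0     = λ u θ₃≈0 → P≉0 (eval-*ₚ-≈0ˡ x P₁ _ (eval-∏ᵥ-≈0 x X₃ u (trans (eval-X₃ u) θ₃≈0)))
      ; minor₂≉0 = λ {u} {v} adm m≈0 → P≉0 (eval-*ₚ-≈0ʳ x P₁ _ (eval-*ₚ-≈0ˡ x P₂ P₃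
          (eval-∏ᵥ-≈0 x _ u (eval-∏ᵥ-≈0 x _ v
            (eval-gate-≈0 (admissible₂? u v) (minor₂ₚ u v) x adm (trans (eval-minor₂ₚ u v) m≈0))))))
      ; minor₃≉0 = λ {u} {v} {w} adm m≈0 → P≉0 (eval-*ₚ-≈0ʳ x P₁ _ (eval-*ₚ-≈0ʳ x P₂ P₃
          (eval-∏ᵥ-≈0 x _ u (eval-∏ᵥ-≈0 x _ v (eval-∏ᵥ-≈0 x _ w
            (eval-gate-≈0 (admissible₃? u v w) (minor₃ₚ u v w) x adm (trans (eval-minor₃ₚ u v w) m≈0)))))))
      }

    Generic⇒eval≉0 : Generic a₁ a₂ a₃ → ¬ eval genericityPolynomial x ≈ 0#
    Generic⇒eval≉0 generic = eval-*ₚ-≉0 x P₁ _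
      (eval-∏ᵥ-≉0 x X₃ (λ u X₃≈0 → θ₃≉0 u (trans (sym (eval-X₃ u)) X₃≈0)))
      (eval-*ₚ-≉0 x P₂ P₃
        (eval-∏ᵥ-≉0 x _ λ u → eval-∏ᵥ-≉0 x _ λ v →
          eval-gate-≉0 (admissible₂? u v) (minor₂ₚ u v) x λ adm m≈0 →
            minor₂≉0 adm (trans (sym (eval-minor₂ₚ u v)) m≈0))
        (eval-∏ᵥ-≉0 x _ λ u → eval-∏ᵥ-≉0 x _ λ v → eval-∏ᵥ-≉0 x _ λ w →
          eval-gate-≉0 (admissible₃? u v w) (minor₃ₚ u v w) x λ adm m≈0 →
            minor₃≉0 adm (trans (sym (eval-minor₃ₚ u v w)) m≈0)))
      where open Generic generic

distinct-nonzero : ∀ {c ℓ} (F : Field c ℓ) → Infinite F → ∀ k → ∃ λ (t : Vec (Field.Carrier F) k) →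
  (∀ i → ¬ Field._≈_ F (lookup t i) (Field.0# F)) × (∀ {i j} → i ≢ j → ¬ Field._≈_ F (lookup t i) (lookup t j))
distinct-nonzero F infinite zero    = Vec.[] , (λ ()) , λ {i} → ⊥-elim (FinP.¬Fin0 i)
distinct-nonzero F infinite (suc k) with distinct-nonzero F infinite k
... | t , t≉0 , t-distinct with infinite (Field.0# F ∷ Vec.toList t)
... | x , x≉0 ∷ x∉t = x Vec.∷ t , ≉0 , distinct
  where
  open Field F hiding (zero)
  x≉t : ∀ {k} (t : Vec Carrier k) → All (λ y → ¬ x ≈ y) (Vec.toList t) → ∀ i → ¬ x ≈ lookup t i
  x≉t (y Vec.∷ t) (x≉y ∷ _)   zero    = x≉y
  x≉t (y Vec.∷ t) (_   ∷ x∉t) (suc i) = x≉t t x∉t i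
  ≉0 : ∀ i → ¬ lookup (x Vec.∷ t) i ≈ 0#
  ≉0 zero    = x≉0
  ≉0 (suc i) = t≉0 i
  distinct : ∀ {i j} → i ≢ j → ¬ lookup (x Vec.∷ t) i ≈ lookup (x Vec.∷ t) j
  distinct {zero}  {zero}  0≢0 = ⊥-elim (0≢0 ≡.refl)
  distinct {zero}  {suc j} _   = x≉t t x∉t j
  distinct {suc i} {zero}  _   = λ tᵢ≈x → x≉t t x∉t i (sym tᵢ≈x)
  distinct {suc i} {suc j} i≢j = t-distinct (λ i≡j → i≢j (≡.cong suc i≡j))

-- Blue vertices are sent to points (1, t, t²) of the moment curve and red vertices to (0, 0, 1);
-- every admissible minor is then a nonzero multiple of a Vandermonde determinant.
module MomentCurveWitness {c ℓ} (F : Field c ℓ) {n} (π : Fin n → Color) where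
  open Field F hiding (zero)
  open StanleyReisner F using (IsBlue)
  open ℤ-CoefficientSolver commutativeRing
  open FieldProperties F using (*-≉0; x≉0⇒-x≉0; x≉y⇒x-y≉0)
  open Determinants F
  open Genericity F π

  ≉-sym : ∀ {x y} → ¬ x ≈ y → ¬ y ≈ x
  ≉-sym x≉y y≈x = x≉y (sym y≈x)

  coord₁ coord₂ coord₃ : Color → Carrier → Carrier
  coord₁ blue t = 1#
  coord₁ red  t = 0#
  coord₂ blue t = t
  coord₂ red  t = 0#
  coord₃ blue t = t * t
  coord₃ red  t = 1#

  coord₃≉0 : ∀ col {t} → ¬ t ≈ 0# → ¬ coord₃ col t ≈ 0#
  coord₃≉0 blue t≉0 = *-≉0 t≉0 t≉0
  coord₃≉0 red  _   = 1≉0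

  det₂-coords≉0 : ∀ cu cv {tu tv} → ¬ tu ≈ 0# → ¬ tv ≈ 0# → ¬ tu ≈ tv → ¬ (cu ≡ red × cv ≡ red) →
    ¬ det₂ (coord₂ cu tu) (coord₃ cu tu) (coord₂ cv tv) (coord₃ cv tv) ≈ 0#
  det₂-coords≉0 blue blue {tu} {tv} tu≉0 tv≉0 tu≉tv _ = λ D≈0 →
    *-≉0 (*-≉0 tu≉0 tv≉0) (x≉y⇒x-y≉0 (λ tv≈tu → tu≉tv (sym tv≈tu))) (trans (sym (solve 2 (λ tu tv →
      tu :* (tv :* tv) :- (tu :* tu) :* tv := (tu :* tv) :* (tv :- tu)) refl tu tv)) D≈0)
  det₂-coords≉0 blue red {tu} tu≉0 _ _ _ = λ D≈0 →
    *-≉0 tu≉0 1≉0 (trans (sym (solve 2 (λ tu o →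
      tu :* o :- (tu :* tu) :* con (+ 0) := tu :* o) refl tu 1#)) D≈0)
  det₂-coords≉0 red blue {_} {tv} _ tv≉0 _ _ = λ D≈0 →
    x≉0⇒-x≉0 (*-≉0 1≉0 tv≉0) (trans (sym (solve 2 (λ tv o →
      con (+ 0) :* (tv :* tv) :- o :* tv := :- (o :* tv)) refl tv 1#)) D≈0)
  det₂-coords≉0 red red _ _ _ ¬bothRed = ⊥-elim (¬bothRed (≡.refl , ≡.refl))

  det₃-coords≉0 : ∀ cu cv cw {tu tv tw} → ¬ tu ≈ tv → ¬ tu ≈ tw → ¬ tv ≈ tw →
    ¬ (cu ≡ red × cv ≡ red) → ¬ (cu ≡ red × cw ≡ red) → ¬ (cv ≡ red × cw ≡ red) →
    ¬ det₃ (coord₁ cu tu) (coord₂ cu tu) (coord₃ cu tu) (coord₁ cv tv) (coord₂ cv tv) (coord₃ cv tv)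
           (coord₁ cw tw) (coord₂ cw tw) (coord₃ cw tw) ≈ 0#
  det₃-coords≉0 blue blue blue {tu} {tv} {tw} tu≉tv tu≉tw tv≉tw _ _ _ = λ D≈0 →
    *-≉0 1≉0 (*-≉0 (x≉y⇒x-y≉0 (≉-sym tu≉tv)) (*-≉0 (x≉y⇒x-y≉0 (≉-sym tu≉tw)) (x≉y⇒x-y≉0 (≉-sym tv≉tw))))
      (trans (sym (solve 4 (λ o tu tv tw →
        o :* (tv :* (tw :* tw) :- (tv :* tv) :* tw) :+ (tu :* ((tv :* tv) :* o :- o :* (tw :* tw))
          :+ (tu :* tu) :* (o :* tw :- tv :* o))
        := o :* ((tv :- tu) :* ((tw :- tu) :* (tw :- tv)))) refl 1# tu tv tw)) D≈0)
  det₃-coords≉0 red blue blue {tu} {tv} {tw} _ _ tv≉tw _ _ _ = λ D≈0 →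
    *-≉0 1≉0 (*-≉0 1≉0 (x≉y⇒x-y≉0 (≉-sym tv≉tw))) (trans (sym (solve 4 (λ o tu tv tw →
      con (+ 0) :* (tv :* (tw :* tw) :- (tv :* tv) :* tw) :+ (con (+ 0) :* ((tv :* tv) :* o :- o :* (tw :* tw))
        :+ o :* (o :* tw :- tv :* o))
      := o :* (o :* (tw :- tv))) refl 1# tu tv tw)) D≈0)
  det₃-coords≉0 blue red blue {tu} {tv} {tw} _ tu≉tw _ _ _ _ = λ D≈0 →
    *-≉0 1≉0 (*-≉0 1≉0 (x≉y⇒x-y≉0 tu≉tw)) (trans (sym (solve 4 (λ o tu tv tw →
      o :* (con (+ 0) :* (tw :* tw) :- o :* tw) :+ (tu :* (o :* o :- con (+ 0) :* (tw :* tw))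
        :+ (tu :* tu) :* (con (+ 0) :* tw :- con (+ 0) :* o))
      := o :* (o :* (tu :- tw))) refl 1# tu tv tw)) D≈0)
  det₃-coords≉0 blue blue red {tu} {tv} {tw} tu≉tv _ _ _ _ _ = λ D≈0 →
    *-≉0 1≉0 (*-≉0 1≉0 (x≉y⇒x-y≉0 (≉-sym tu≉tv))) (trans (sym (solve 4 (λ o tu tv tw →
      o :* (tv :* o :- (tv :* tv) :* con (+ 0)) :+ (tu :* ((tv :* tv) :* con (+ 0) :- o :* o)
        :+ (tu :* tu) :* (o :* con (+ 0) :- tv :* con (+ 0)))
      := o :* (o :* (tv :- tu))) refl 1# tu tv tw)) D≈0)
  det₃-coords≉0 red  red  _    _ _ _ ¬uv _ _ = ⊥-elim (¬uv (≡.refl , ≡.refl))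
  det₃-coords≉0 red  blue red  _ _ _ _ ¬uw _ = ⊥-elim (¬uw (≡.refl , ≡.refl))
  det₃-coords≉0 blue red  red  _ _ _ _ _ ¬vw = ⊥-elim (¬vw (≡.refl , ≡.refl))

  module _ (t : Vec Carrier n) where
    witness₁ witness₂ witness₃ : Vec Carrier n
    witness₁ = tabulate (λ v → coord₁ (π v) (lookup t v))
    witness₂ = tabulate (λ v → coord₂ (π v) (lookup t v))
    witness₃ = tabulate (λ v → coord₃ (π v) (lookup t v))

    lookup-witness₁ : ∀ v → lookup witness₁ v ≈ coord₁ (π v) (lookup t v)
    lookup-witness₁ v = reflexive (VecP.lookup∘tabulate _ v)

    lookup-witness₂ : ∀ v → lookup witness₂ v ≈ coord₂ (π v) (lookup t v)
    lookup-witness₂ v = reflexive (VecP.lookup∘tabulate _ v)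

    lookup-witness₃ : ∀ v → lookup witness₃ v ≈ coord₃ (π v) (lookup t v)
    lookup-witness₃ v = reflexive (VecP.lookup∘tabulate _ v)

    witness₁-blue : IsBlue π witness₁
    witness₁-blue v πv≡red =
      trans (lookup-witness₁ v) (≡.subst (λ col → coord₁ col (lookup t v) ≈ 0#) (≡.sym πv≡red) refl)

    witness₂-blue : IsBlue π witness₂
    witness₂-blue v πv≡red =
      trans (lookup-witness₂ v) (≡.subst (λ col → coord₂ col (lookup t v) ≈ 0#) (≡.sym πv≡red) refl)

    witness-generic : (∀ i → ¬ lookup t i ≈ 0#) → (∀ {i j} → i ≢ j → ¬ lookup t i ≈ lookup t j) →
      Generic witness₁ witness₂ witness₃
    witness-generic t≉0 t-distinct = record
      { θ₃≉0     = λ u w≈0 → coord₃≉0 (π u) (t≉0 u) (trans (sym (lookup-witness₃ u)) w≈0)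
      ; minor₂≉0 = λ { {u} {v} (u≢v , ¬red) m≈0 → det₂-coords≉0 (π u) (π v) (t≉0 u) (t≉0 v) (t-distinct u≢v) ¬red
          (trans (sym (det₂-cong (lookup-witness₂ u) (lookup-witness₃ u) (lookup-witness₂ v) (lookup-witness₃ v))) m≈0) }
      ; minor₃≉0 = λ { {u} {v} {w} ((u≢v , ¬uv) , (u≢w , ¬uw) , (v≢w , ¬vw)) m≈0 →
          det₃-coords≉0 (π u) (π v) (π w) (t-distinct u≢v) (t-distinct u≢w) (t-distinct v≢w) ¬uv ¬uw ¬vw
          (trans (sym (det₃-cong (lookup-witness₁ u) (lookup-witness₂ u) (lookup-witness₃ u)
                                 (lookup-witness₁ v) (lookup-witness₂ v) (lookup-witness₃ v)
                                 (lookup-witness₁ w) (lookup-witness₂ w) (lookup-witness₃ w))) m≈0) }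
      }

open import Data.Nat using (_+_)
open import Data.Vec using (_++_)

module _ {c ℓ} (F : Field c ℓ) {n} (π : Fin n → Color) where
  open Field F using (Carrier; _≈_; 0#)
  open Polynomials F using (eval)
  open StanleyReisner F using (IsBlue; IsLSOP)
  open GenericityPolynomial F π

  genericityPolynomial-≉0-at-blue-point : Infinite F →
    ∃ λ (a₁ : Vec Carrier n) → ∃ λ (a₂ : Vec Carrier n) → ∃ λ (a₃ : Vec Carrier n) →
      IsBlue π a₁ × IsBlue π a₂ × ¬ eval genericityPolynomial (a₁ ++ a₂ ++ a₃) ≈ 0#
  genericityPolynomial-≉0-at-blue-point infinite with distinct-nonzero F infinite n
  ... | t , t≉0 , t-distinct =
    witness₁ t , witness₂ t , witness₃ t , witness₁-blue t , witness₂-blue t ,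
    Generic⇒eval≉0 (witness₁ t) (witness₂ t) (witness₃ t) (witness-generic t t≉0 t-distinct)
    where open MomentCurveWitness F π

  genericityPolynomial-≉0⇒IsLSOP : (Δ : SimplicialComplex n) → (∀ S → Face Δ S → ∣ S ∣ ≤ 3) → SemiProper Δ π →
    ∀ a₁ a₂ a₃ → ¬ eval genericityPolynomial (a₁ ++ a₂ ++ a₃) ≈ 0# → IsLSOP Δ a₁ a₂ a₃
  genericityPolynomial-≉0⇒IsLSOP Δ faces≤3 semiProper a₁ a₂ a₃ P≉0 = Spanning.finiteDimQuotient F Δ a₁ a₂ a₃
    (HighPowers.u⁴∈J F Δ π faces≤3 semiProper a₁ a₂ a₃ (eval≉0⇒Generic a₁ a₂ a₃ P≉0))

lemma4p3 : ∀ {c ℓ} (F : Field c ℓ) → Infinite F →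
    ∀ {n} (Δ : SimplicialComplex n) → Is2Dimensional Δ →
    (π : Fin n → Color) → SemiProper Δ π →
    ∃ λ (P : Polynomials.Poly F (n + (n + n))) →
      (∃ λ (a₁ : Vec (Field.Carrier F) n) → ∃ λ (a₂ : Vec (Field.Carrier F) n) →
        ∃ λ (a₃ : Vec (Field.Carrier F) n) →
          StanleyReisner.IsBlue F π a₁ × StanleyReisner.IsBlue F π a₂ ×
          ¬ Field._≈_ F (Polynomials.eval F P (a₁ ++ a₂ ++ a₃)) (Field.0# F))
      ×
      (∀ (a₁ a₂ a₃ : Vec (Field.Carrier F) n) →
        StanleyReisner.IsBlue F π a₁ → StanleyReisner.IsBlue F π a₂ →
        ¬ Field._≈_ F (Polynomials.eval F P (a₁ ++ a₂ ++ a₃)) (Field.0# F) →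
        StanleyReisner.IsLSOP F Δ a₁ a₂ a₃)
-- The blueness hypotheses are only needed to place the witness point, not for the parameter property.
lemma4p3 F infinite Δ (faces≤3 , _) π semiProper =
  GenericityPolynomial.genericityPolynomial F π ,
  genericityPolynomial-≉0-at-blue-point F π infinite ,
  λ a₁ a₂ a₃ _ _ → genericityPolynomial-≉0⇒IsLSOP F π Δ faces≤3 semiProper a₁ a₂ a₃
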